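{- Let $q$ be a prime power and let $\epsilon=(u_1,v_1,u_2,v_2,u_3,v_3,u_4,v_4)$ be a tuple over $\mathbb{F}_q^*$. (a) $\Lambda_{3,q}$ has a cycle of type $\epsilon$ with $v_1+v_2=0$ iff $\epsilon=(r,s,t,-s,-r,s,-t,-s)$ for some $r,s,t\in\mathbb{F}_q^*$. (b) $\Lambda_{4,q}$ has a cycle of type $\epsilon$ with $v_1+v_2=0$ iff the characteristic of $\mathbb{F}_q$ is $2$ and $\epsilon=(r,s,t,-s,-r,s,-t,-s)$ for some $r,s,t\in\mathbb{F}_q^*$. (c) $\Lambda_{3,q}$ has a cycle of type $\epsilon$ with $v_1+v_2\ne0$ iff there exist $t\in\mathbb{F}_q^*$ and distinct $a,b,c\in\mathbb{F}_q^*$ with $v_1=a$, $v_2=b-a$, $v_3=c-b$, $v_4=-c$, $u_2=tbc(c-b)$, $u_3=tac(a-c)$, $u_4=tab(b-a)$, $u_1=t(c-b)(a-c)(b-a)$. (d) $\Lambda_{4,q}$ has a cycle of type $\epsilon$ with $v_1+v_2\ne0$ iff there exist $t\in\mathbb{F}_q^*$ and distinct $a,b,c\in\mathbb{F}_q^*$ with $a+c=b$ such that the equalities in (c) hold. (e) For $q>3$, $g(\Lambda_{3,q})=g(\Lambda_{4,q})=8$. (f) $g(\Lambda_{3,3})=8$ and $g(\Lambda_{4,3})\ge10$. (g) For $q\ge3$, $g(\Lambda_{5,q})\ge10$.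
   Context: For a prime power $q$ and integer $k\ge2$, $\Lambda_{k,q}$ is the bipartite graph with vertex set $L_k\cup R_k$ (regarded as disjoint), where $L_k$ is the set of vectors $[l]=(l_0,\dots,l_k)\in\mathbb{F}_q^{k+1}$ with $l_1=l_2$ and $R_k$ the set of vectors $\langle r\rangle=(r_0,\dots,r_k)\in\mathbb{F}_q^{k+1}$ with $r_1=0$; edges join only $L_k$ to $R_k$, and $[l]\sim\langle r\rangle$ iff for every $2\le i\le k$: $l_i+r_i=r_0l_{i-2}$ if $i\equiv2,3\pmod4$, and $l_i+r_i=l_0r_{i-2}$ if $i\equiv0,1\pmod4$. A cycle of length $2n$ through the edge joining the two all-zero vectors is written $[l^{(1)}],\langle r^{(1)}\rangle,\dots,[l^{(n)}],\langle r^{(n)}\rangle$ (distinct vertices, consecutive ones adjacent, $\langle r^{(n)}\rangle\sim[l^{(1)}]$) with $[l^{(1)}]$ and $\langle r^{(1)}\rangle$ the all-zero vectors. Put $x_i=l^{(i)}_0$, $y_i=r^{(i)}_0$ ($1\le i\le n$), $x_{n+1}=y_{n+1}=0$, $u_i=x_{i+1}-x_i$, $v_i=y_{i+1}-y_i$; the tuple $(u_1,v_1,\dots,u_n,v_n)$ is the type of the cycle, and "$\Lambda_{k,q}$ has a cycle of type $\epsilon$" means such a cycle with type $\epsilon$ exists. $g(G)$ is the girth of $G$. -}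

module Defs where

open import Level using (0ℓ)
open import Data.Nat using (ℕ; zero; suc; _≤_; _<_; _%_; _∸_)
open import Data.Nat.DivMod using (_mod_)
open import Data.Fin using (Fin; toℕ) renaming (zero to fzero; suc to fsuc)
open import Data.Vec using (Vec; []; _∷_; replicate)
open import Data.Bool using (Bool; true; false; if_then_else_)
open import Data.Sum using (_⊎_; inj₁; inj₂)
open import Data.Product using (Σ; ∃; _×_; _,_)
open import Data.Empty using (⊥)
open import Relation.Nullary using (¬_)
open import Relation.Binary.PropositionalEquality using (_≡_; _≢_)
open import Algebra.Structures using (IsCommutativeRing)
open import Function.Bundles using (_↔_)

-- A finite field with q elements (𝔽_q).  Equality is propositional.
-- Any such q is necessarily a prime power, and 𝔽_q is unique up to
-- isomorphism, so quantifying over all of them is faithful.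

record FiniteField (q : ℕ) : Set₁ where
  infixl 6 _+_
  infixl 7 _*_
  infix  8 -_
  field
    Carrier : Set
    _+_ _*_ : Carrier → Carrier → Carrier
    -_      : Carrier → Carrier
    0# 1#   : Carrier
    isCommutativeRing : IsCommutativeRing _≡_ _+_ _*_ -_ 0# 1#
    0≢1     : 0# ≢ 1#
    inverse : ∀ x → x ≢ 0# → ∃ λ y → x * y ≡ 1#
    enum    : Carrier ↔ Fin q

  infixl 6 _-_
  _-_ : Carrier → Carrier → Carrier
  x - y = x + - y

next : ∀ {n} → Fin n → Fin n
next {suc m} i = suc (toℕ i) mod suc m

phase23 : ℕ → Bool
phase23 n with n % 4
... | 2 = true
... | 3 = true
... | _ = false

module Lambda {q : ℕ} (F : FiniteField q) where
  open FiniteField F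

  -- coordinate i of a vector (0 outside the range; only used in range)
  at : ∀ {n} → Vec Carrier n → ℕ → Carrier
  at []       _       = 0#
  at (x ∷ xs) zero    = x
  at (x ∷ xs) (suc i) = at xs i

  V : ℕ → Set
  V k = Vec Carrier (suc k)

  zeroV : ∀ k → V k
  zeroV k = replicate (suc k) 0#

  InL : ∀ {k} → V k → Set
  InL l = at l 1 ≡ at l 2

  InR : ∀ {k} → V k → Set
  InR r = at r 1 ≡ 0#

  Adj : ∀ k → V k → V k → Set
  Adj k l r = ∀ i → 2 ≤ i → i ≤ k →
    at l i + at r i ≡
      (if phase23 i then at r 0 * at l (i ∸ 2) else at l 0 * at r (i ∸ 2))

  Vertex : ℕ → Set
  Vertex k = V k ⊎ V k

  IsVertex : ∀ {k} → Vertex k → Set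
  IsVertex (inj₁ l) = InL l
  IsVertex (inj₂ r) = InR r

  Edge : ∀ k → Vertex k → Vertex k → Set
  Edge k (inj₁ l) (inj₂ r) = Adj k l r
  Edge k (inj₂ r) (inj₁ l) = Adj k l r
  Edge k (inj₁ _) (inj₁ _) = ⊥
  Edge k (inj₂ _) (inj₂ _) = ⊥

  HasCycle : ℕ → ℕ → Set
  HasCycle k m = 3 ≤ m × Σ (Fin m → Vertex k) λ f →
      (∀ i → IsVertex (f i))
    × (∀ i j → f i ≡ f j → i ≡ j)
    × (∀ i → Edge k (f i) (f (next i)))

  GirthEq : ℕ → ℕ → Set
  GirthEq k g = HasCycle k g × (∀ m → m < g → ¬ HasCycle k m)

  -- g(Λ_{k,q}) ≥ g   (no cycle shorter than g; includes girth ∞)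
  GirthGe : ℕ → ℕ → Set
  GirthGe k g = ∀ m → m < g → ¬ HasCycle k m

  -- Cycles of length 2n (n = suc m) through the edge [0]~⟨0⟩, with type (u,v):
  -- [l(0)],⟨r(0)⟩,[l(1)],⟨r(1)⟩,…,[l(m)],⟨r(m)⟩ (0-based indices).
  -- Since x₁ = y₁ = 0, x_{n+1} = y_{n+1} = 0 means indices are read cyclically.
  record TypedCycle (k m : ℕ) (u v : Vec Carrier (suc m)) : Set where
    field
      l r    : Fin (suc m) → V k
      l∈L    : ∀ i → InL (l i)
      r∈R    : ∀ i → InR (r i)
      l-inj  : ∀ i j → l i ≡ l j → i ≡ j
      r-inj  : ∀ i j → r i ≡ r j → i ≡ j
      adj-lr : ∀ i → Adj k (l i) (r i)
      adj-rl : ∀ i → Adj k (l (next i)) (r i)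
      l₀     : l fzero ≡ zeroV k
      r₀     : r fzero ≡ zeroV k
      u-def  : ∀ i → Data.Vec.lookup u i ≡ at (l (next i)) 0 - at (l i) 0
      v-def  : ∀ i → Data.Vec.lookup v i ≡ at (r (next i)) 0 - at (r i) 0

  HasType8 : ℕ → (u₁ v₁ u₂ v₂ u₃ v₃ u₄ v₄ : Carrier) → Set
  HasType8 k u₁ v₁ u₂ v₂ u₃ v₃ u₄ v₄ =
    TypedCycle k 3 (u₁ ∷ u₂ ∷ u₃ ∷ u₄ ∷ []) (v₁ ∷ v₂ ∷ v₃ ∷ v₄ ∷ [])

  NonZero8 : (u₁ v₁ u₂ v₂ u₃ v₃ u₄ v₄ : Carrier) → Set
  NonZero8 u₁ v₁ u₂ v₂ u₃ v₃ u₄ v₄ =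
    u₁ ≢ 0# × v₁ ≢ 0# × u₂ ≢ 0# × v₂ ≢ 0# × u₃ ≢ 0# × v₃ ≢ 0# × u₄ ≢ 0# × v₄ ≢ 0#

  SpecialForm : (u₁ v₁ u₂ v₂ u₃ v₃ u₄ v₄ : Carrier) → Set
  SpecialForm u₁ v₁ u₂ v₂ u₃ v₃ u₄ v₄ =
    Σ Carrier λ r → Σ Carrier λ s → Σ Carrier λ t →
      r ≢ 0# × s ≢ 0# × t ≢ 0# ×
      u₁ ≡ r × v₁ ≡ s × u₂ ≡ t × v₂ ≡ - s ×
      u₃ ≡ - r × v₃ ≡ s × u₄ ≡ - t × v₄ ≡ - s

  EqsC : (t a b c : Carrier) → (u₁ v₁ u₂ v₂ u₃ v₃ u₄ v₄ : Carrier) → Set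
  EqsC t a b c u₁ v₁ u₂ v₂ u₃ v₃ u₄ v₄ =
      v₁ ≡ a × v₂ ≡ b - a × v₃ ≡ c - b × v₄ ≡ - c
    × u₂ ≡ t * b * c * (c - b)
    × u₃ ≡ t * a * c * (a - c)
    × u₄ ≡ t * a * b * (b - a)
    × u₁ ≡ t * (c - b) * (a - c) * (b - a)

  GoodTABC : (t a b c : Carrier) → Set
  GoodTABC t a b c =
    t ≢ 0# × a ≢ 0# × b ≢ 0# × c ≢ 0# × a ≢ b × b ≢ c × a ≢ c

  Char2 : Set
  Char2 = 1# + 1# ≡ 0#

{-# OPTIONS --safe #-}
module Submission where

-- Let l — r — l' be a path in Λ_{k,q} and write x = l₀, b = l₁ = l₂, c = l₃, d = l₄, e = l₅,
-- y = r₀ and u = l'₀ − l₀.  Adjacency determines r from (l, y) and l' from (r, u), and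
--   l'₂ = b + y u,  l'₃ = c + y² u,  l'₄ = d + (y x − b) u,  l'₅ = e + (y b − c) u.
-- So an 8-cycle is a closed walk of four such steps, and every coordinate j ≤ k gives an
-- equation saying that the walk closes in that coordinate.  Shifting y so that y₁ = 0 and
-- writing A, B, C for the other three y's, coordinates 0, 2 and 3 say that (u₁,…,u₄) is
-- annihilated by the rows (1,1,1,1), (0,A,B,C), (0,A²,B²,C²).  Hence either B = 0, and
-- then C = A and the type is (r,s,t,−s,−r,s,−t,−s), or (u₁,…,u₄) is a multiple of the
-- vector of 3 × 3 minors.  For k = 4 coordinate 4 then evaluates to 2 A u₁ u₂,
-- resp. to a nonzero multiple of A + C − B, and for k = 5 coordinate 5 never vanishes.
-- Conversely, walking from the origin with such increments closes up and gives the cycle.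
-- The same bookkeeping kills 4- and 6-cycles, odd cycles are impossible in a bipartite
-- graph, and over 𝔽₃ neither shape fits: 1 + 1 ≠ 0, and there are no three distinct
-- nonzero elements.

open import Defs
open import Data.Nat using (ℕ; _<_; _≤_)
open import Data.Product using (Σ; _×_)
open import Relation.Nullary using (¬_)
open import Relation.Binary.PropositionalEquality using (_≡_; _≢_)
open import Function.Bundles using (_⇔_)

open import Level using (0ℓ)
open import Algebra.Bundles using (CommutativeRing; RawRing)
open import Algebra.Structures using (IsCommutativeRing)
open import Data.Bool using (Bool; true; false; T; not; if_then_else_)
open import Data.Bool.Properties using (not-involutive; not-¬)
open import Data.Fin using (Fin; remQuot; combine; inject≤)
open import Data.Fin.Patterns using (0F; 1F; 2F; 3F; 4F; 5F; 6F; 7F)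
import Data.Fin.Properties as Finₚ
open import Data.Integer as ℤ using (ℤ; -[1+_]) renaming (+_ to pos)
import Data.Integer.Properties as ℤₚ
open import Data.Maybe using (nothing)
open import Data.Nat as ℕ using (zero; suc; _∸_; z≤n; s≤s)
import Data.Nat.Properties as ℕₚ
open import Data.Empty using (⊥; ⊥-elim)
open import Data.Product using (∃; _,_; proj₁; proj₂; uncurry)
open import Data.Sum using (_⊎_; inj₁; inj₂; [_,_]′)
open import Data.Sum.Properties using (inj₁-injective; inj₂-injective)
open import Data.Vec using (Vec; []; _∷_; lookup)
open import Function using (_∘_; id)
open import Function.Bundles using (Inverse; Injection; mk⇔)
open import Function.Properties.Inverse using (↔⇒↣; ↔-sym)
open import Relation.Binary.Definitions using (tri<; tri≈; tri>)
open import Relation.Binary.PropositionalEquality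
  using (refl; sym; trans; cong; cong₂; subst; setoid; module ≡-Reasoning)
open import Relation.Nullary using (Dec; yes; no)
open import Tactic.RingSolver.Core.AlmostCommutativeRing using (AlmostCommutativeRing; fromCommutativeRing)
open import Tactic.RingSolver.Core.Polynomial.Parameters using (Homomorphism)
open import Tactic.RingSolver.Core.Expression using (Expr; Κ; Ι; _⊕_; _⊗_; _⊛_; ⊝_; module Eval)

-- The ring solver of Tactic.RingSolver with integer coefficients, for any commutative ring
-- with propositional equality: coefficients taken from the ring itself would not cancel
-- (x − x would not normalise to 0).
module IntegerCoefficientSolver (R : RawRing 0ℓ 0ℓ)
  (isCommutativeRing : IsCommutativeRing _≡_ (RawRing._+_ R) (RawRing._*_ R) (RawRing.-_ R) (RawRing.0# R) (RawRing.1# R))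
  where

  open RawRing R renaming (Carrier to A)

  private
    CR : CommutativeRing 0ℓ 0ℓ
    CR = record { isCommutativeRing = isCommutativeRing }

    ACR : AlmostCommutativeRing 0ℓ 0ℓ
    ACR = fromCommutativeRing CR (λ _ → nothing)

    open CommutativeRing CR
      using (+-assoc; +-comm; +-identityˡ; +-identityʳ; *-identityˡ; distribʳ; zeroˡ; -‿inverseˡ; -‿inverseʳ; ring)
    open import Algebra.Properties.Ring ring
      using (-‿involutive; -‿distribˡ-*; -0#≈0#; -‿anti-homo-+)
    open ≡-Reasoning

    ⟦_⟧ℕ : ℕ → A
    ⟦ zero ⟧ℕ        = 0#
    ⟦ suc zero ⟧ℕ    = 1#
    ⟦ suc (suc n) ⟧ℕ = 1# + ⟦ suc n ⟧ℕ

    ⟦suc⟧ℕ : ∀ n → ⟦ suc n ⟧ℕ ≡ 1# + ⟦ n ⟧ℕ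
    ⟦suc⟧ℕ zero    = sym (+-identityʳ 1#)
    ⟦suc⟧ℕ (suc n) = refl

    ⟦_⟧ℤ : ℤ → A
    ⟦ pos n ⟧ℤ      = ⟦ n ⟧ℕ
    ⟦ -[1+ n ] ⟧ℤ = - ⟦ suc n ⟧ℕ

    ⟦-⟧ : ∀ i → ⟦ ℤ.- i ⟧ℤ ≡ - ⟦ i ⟧ℤ
    ⟦-⟧ (pos zero)  = sym -0#≈0#
    ⟦-⟧ (pos (suc n)) = refl
    ⟦-⟧ -[1+ n ]  = sym (-‿involutive _)

    1+[-[1+x]]≡-x : ∀ x → 1# + - (1# + x) ≡ - x
    1+[-[1+x]]≡-x x = begin
      1# + - (1# + x)   ≡⟨ cong (1# +_) (trans (-‿anti-homo-+ 1# x) (+-comm (- x) (- 1#))) ⟩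
      1# + (- 1# + - x) ≡⟨ sym (+-assoc _ _ _) ⟩
      (1# + - 1#) + - x ≡⟨ cong (_+ - x) (-‿inverseʳ 1#) ⟩
      0# + - x          ≡⟨ +-identityˡ _ ⟩
      - x               ∎

    ⟦1+⟧ : ∀ i → ⟦ ℤ.1ℤ ℤ.+ i ⟧ℤ ≡ 1# + ⟦ i ⟧ℤ
    ⟦1+⟧ (pos n)            = ⟦suc⟧ℕ n
    ⟦1+⟧ -[1+ zero ]      = sym (-‿inverseʳ 1#)
    ⟦1+⟧ -[1+ suc n ]     =
      trans (sym (1+[-[1+x]]≡-x ⟦ suc n ⟧ℕ)) (cong (λ z → 1# + - z) (sym (⟦suc⟧ℕ (suc n))))

    ⟦-1+⟧ : ∀ i → ⟦ ℤ.-1ℤ ℤ.+ i ⟧ℤ ≡ - 1# + ⟦ i ⟧ℤ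
    ⟦-1+⟧ i = begin
      ⟦ ℤ.-1ℤ ℤ.+ i ⟧ℤ                   ≡⟨ sym (+-identityˡ _) ⟩
      0# + ⟦ ℤ.-1ℤ ℤ.+ i ⟧ℤ              ≡⟨ cong (_+ ⟦ ℤ.-1ℤ ℤ.+ i ⟧ℤ) (sym (-‿inverseˡ 1#)) ⟩
      (- 1# + 1#) + ⟦ ℤ.-1ℤ ℤ.+ i ⟧ℤ     ≡⟨ +-assoc _ _ _ ⟩
      - 1# + (1# + ⟦ ℤ.-1ℤ ℤ.+ i ⟧ℤ)     ≡⟨ cong (- 1# +_) (sym (⟦1+⟧ (ℤ.-1ℤ ℤ.+ i))) ⟩
      - 1# + ⟦ ℤ.1ℤ ℤ.+ (ℤ.-1ℤ ℤ.+ i) ⟧ℤ ≡⟨ cong (λ j → - 1# + ⟦ j ⟧ℤ) (trans (sym (ℤₚ.+-assoc ℤ.1ℤ ℤ.-1ℤ i)) (ℤₚ.+-identityˡ i)) ⟩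
      - 1# + ⟦ i ⟧ℤ                      ∎

    ⟦+⟧ : ∀ i j → ⟦ i ℤ.+ j ⟧ℤ ≡ ⟦ i ⟧ℤ + ⟦ j ⟧ℤ
    ⟦+⟧ (pos zero) j = trans (cong ⟦_⟧ℤ (ℤₚ.+-identityˡ j)) (sym (+-identityˡ _))
    ⟦+⟧ (pos (suc n)) j = begin
      ⟦ pos (suc n) ℤ.+ j ⟧ℤ      ≡⟨ cong ⟦_⟧ℤ (ℤₚ.+-assoc ℤ.1ℤ (pos n) j) ⟩
      ⟦ ℤ.1ℤ ℤ.+ (pos n ℤ.+ j) ⟧ℤ ≡⟨ ⟦1+⟧ (pos n ℤ.+ j) ⟩
      1# + ⟦ pos n ℤ.+ j ⟧ℤ       ≡⟨ cong (1# +_) (⟦+⟧ (pos n) j) ⟩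
      1# + (⟦ n ⟧ℕ + ⟦ j ⟧ℤ)      ≡⟨ sym (+-assoc _ _ _) ⟩
      (1# + ⟦ n ⟧ℕ) + ⟦ j ⟧ℤ      ≡⟨ cong (_+ ⟦ j ⟧ℤ) (sym (⟦suc⟧ℕ n)) ⟩
      ⟦ suc n ⟧ℕ + ⟦ j ⟧ℤ         ∎
    ⟦+⟧ -[1+ zero ] j = ⟦-1+⟧ j
    ⟦+⟧ -[1+ suc n ] j = begin
      ⟦ -[1+ suc n ] ℤ.+ j ⟧ℤ         ≡⟨ cong ⟦_⟧ℤ (ℤₚ.+-assoc ℤ.-1ℤ -[1+ n ] j) ⟩
      ⟦ ℤ.-1ℤ ℤ.+ (-[1+ n ] ℤ.+ j) ⟧ℤ ≡⟨ ⟦-1+⟧ (-[1+ n ] ℤ.+ j) ⟩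
      - 1# + ⟦ -[1+ n ] ℤ.+ j ⟧ℤ      ≡⟨ cong (- 1# +_) (⟦+⟧ -[1+ n ] j) ⟩
      - 1# + (- ⟦ suc n ⟧ℕ + ⟦ j ⟧ℤ)  ≡⟨ sym (+-assoc _ _ _) ⟩
      (- 1# + - ⟦ suc n ⟧ℕ) + ⟦ j ⟧ℤ  ≡⟨ cong (_+ ⟦ j ⟧ℤ) (sym (-‿anti-homo-+ ⟦ suc n ⟧ℕ 1#)) ⟩
      - (⟦ suc n ⟧ℕ + 1#) + ⟦ j ⟧ℤ    ≡⟨ cong (λ z → - z + ⟦ j ⟧ℤ) (trans (+-comm _ 1#) (sym (⟦suc⟧ℕ (suc n)))) ⟩
      - ⟦ suc (suc n) ⟧ℕ + ⟦ j ⟧ℤ     ∎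

    ⟦+*⟧ : ∀ n j → ⟦ pos n ℤ.* j ⟧ℤ ≡ ⟦ n ⟧ℕ * ⟦ j ⟧ℤ
    ⟦+*⟧ zero j = trans (cong ⟦_⟧ℤ (ℤₚ.*-zeroˡ j)) (sym (zeroˡ _))
    ⟦+*⟧ (suc n) j = begin
      ⟦ pos (suc n) ℤ.* j ⟧ℤ        ≡⟨ cong ⟦_⟧ℤ (trans (ℤₚ.*-distribʳ-+ j ℤ.1ℤ (pos n)) (cong (ℤ._+ (pos n ℤ.* j)) (ℤₚ.*-identityˡ j))) ⟩
      ⟦ j ℤ.+ pos n ℤ.* j ⟧ℤ        ≡⟨ ⟦+⟧ j (pos n ℤ.* j) ⟩
      ⟦ j ⟧ℤ + ⟦ pos n ℤ.* j ⟧ℤ     ≡⟨ cong₂ _+_ (sym (*-identityˡ _)) (⟦+*⟧ n j) ⟩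
      1# * ⟦ j ⟧ℤ + ⟦ n ⟧ℕ * ⟦ j ⟧ℤ ≡⟨ sym (distribʳ _ _ _) ⟩
      (1# + ⟦ n ⟧ℕ) * ⟦ j ⟧ℤ        ≡⟨ cong (_* ⟦ j ⟧ℤ) (sym (⟦suc⟧ℕ n)) ⟩
      ⟦ suc n ⟧ℕ * ⟦ j ⟧ℤ           ∎

    ⟦*⟧ : ∀ i j → ⟦ i ℤ.* j ⟧ℤ ≡ ⟦ i ⟧ℤ * ⟦ j ⟧ℤ
    ⟦*⟧ (pos n) j = ⟦+*⟧ n j
    ⟦*⟧ -[1+ n ] j = begin
      ⟦ -[1+ n ] ℤ.* j ⟧ℤ          ≡⟨ cong ⟦_⟧ℤ (sym (ℤₚ.neg-distribˡ-* (pos (suc n)) j)) ⟩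
      ⟦ ℤ.- (pos (suc n) ℤ.* j) ⟧ℤ ≡⟨ ⟦-⟧ (pos (suc n) ℤ.* j) ⟩
      - ⟦ pos (suc n) ℤ.* j ⟧ℤ     ≡⟨ cong -_ (⟦+*⟧ (suc n) j) ⟩
      - (⟦ suc n ⟧ℕ * ⟦ j ⟧ℤ)      ≡⟨ -‿distribˡ-* _ _ ⟩
      - ⟦ suc n ⟧ℕ * ⟦ j ⟧ℤ        ∎

    isZero : ℤ → Bool
    isZero (pos zero) = true
    isZero _        = false

    isZero-sound : ∀ i → T (isZero i) → 0# ≡ ⟦ i ⟧ℤ
    isZero-sound (pos zero) _ = refl

    homomorphism : Homomorphism 0ℓ 0ℓ 0ℓ 0ℓ
    homomorphism = record
      { from          = record { rawRing = ℤ.+-*-rawRing ; isZero = isZero }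
      ; to            = ACR
      ; morphism      = record
        { ⟦_⟧ = ⟦_⟧ℤ ; +-homo = ⟦+⟧ ; *-homo = ⟦*⟧ ; -‿homo = ⟦-⟧ ; 0-homo = refl ; 1-homo = refl }
      ; Zero-C⟶Zero-R = isZero-sound
      }

    open Eval (AlmostCommutativeRing.rawRing ACR) ⟦_⟧ℤ
    open import Tactic.RingSolver.Core.Polynomial.Base (Homomorphism.from homomorphism)
    open import Tactic.RingSolver.Core.Polynomial.Semantics homomorphism renaming (⟦_⟧ to ⟦_⟧ₚ)
    open import Tactic.RingSolver.Core.Polynomial.Homomorphism homomorphism

    norm : ∀ {n} → Expr ℤ n → Poly n
    norm (Κ x)   = κ x
    norm (Ι x)   = ι x
    norm (x ⊕ y) = norm x ⊞ norm y
    norm (x ⊗ y) = norm x ⊠ norm y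
    norm (⊝ x)   = ⊟ norm x
    norm (x ⊛ i) = norm x ⊡ i

    ⟦_⇓⟧ : ∀ {n} → Expr ℤ n → Vec A n → A
    ⟦ e ⇓⟧ = ⟦ norm e ⟧ₚ

    correct : ∀ {n} (e : Expr ℤ n) ρ → ⟦ e ⇓⟧ ρ ≡ ⟦ e ⟧ ρ
    correct (Κ x)   ρ = κ-hom x ρ
    correct (Ι x)   ρ = ι-hom x ρ
    correct (x ⊕ y) ρ = trans (⊞-hom (norm x) (norm y) ρ) (cong₂ _+_ (correct x ρ) (correct y ρ))
    correct (x ⊗ y) ρ = trans (⊠-hom (norm x) (norm y) ρ) (cong₂ _*_ (correct x ρ) (correct y ρ))
    correct (⊝ x)   ρ = trans (⊟-hom (norm x) ρ) (cong -_ (correct x ρ))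
    correct (x ⊛ i) ρ = trans (⊡-hom (norm x) i ρ) (cong (λ z → AlmostCommutativeRing._^_ ACR z i) (correct x ρ))

  open import Relation.Binary.Reflection (setoid A) Ι ⟦_⟧ ⟦_⇓⟧ correct public using (solve)

  infixl 6 _:+_ _:-_
  infixl 7 _:*_
  infix  8 :-_
  infix  4 _:=_

  _:+_ _:*_ _:-_ : ∀ {n} → Expr ℤ n → Expr ℤ n → Expr ℤ n
  a :+ b = a ⊕ b
  a :* b = a ⊗ b
  a :- b = a ⊕ (⊝ b)

  :-_ : ∀ {n} → Expr ℤ n → Expr ℤ n
  :-_ = ⊝_

  :0 :1 : ∀ {n} → Expr ℤ n
  :0 = Κ (pos 0)
  :1 = Κ (pos 1)

  _:=_ : ∀ {n} → Expr ℤ n → Expr ℤ n → Expr ℤ n × Expr ℤ n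
  a := b = a , b

-- Defined over an arbitrary raw ring so that the same walks serve both as field elements and,
-- instantiated at solver expressions, as goals for `solve`.
module RawRingWalk (R : RawRing 0ℓ 0ℓ) where
  open RawRing R

  infixl 6 _-_
  _-_ : Carrier → Carrier → Carrier
  x - y = x + - y

  -- The coordinates l₀, l₂ (= l₁), l₃, l₄, l₅ of an L-vertex l.
  record Point : Set where
    constructor point
    field x b c d e : Carrier

  origin : Point
  origin = point 0# 0# 0# 0# 0#

  -- From l through its R-neighbour with first coordinate y to the L-neighbour with
  -- first coordinate x + u.
  step : Carrier → Carrier → Point → Point
  step y u (point x b c d e) =
    point (x + u) (b + y * u) (c + y * (y * u)) (d + (y * x - b) * u) (e + (y * b - c) * u)

  walk₁ : (u₁ : Carrier) → Point
  walk₁ u₁ = step 0# u₁ origin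

  walk₂ : (A u₁ u₂ : Carrier) → Point
  walk₂ A u₁ u₂ = step A u₂ (walk₁ u₁)

  walk₃ : (A B u₁ u₂ u₃ : Carrier) → Point
  walk₃ A B u₁ u₂ u₃ = step B u₃ (walk₂ A u₁ u₂)

  walk : (A B C u₁ u₂ u₃ u₄ : Carrier) → Point
  walk A B C u₁ u₂ u₃ u₄ = step C u₄ (walk₃ A B u₁ u₂ u₃)

  symmetricWalk : (A u₁ u₂ : Carrier) → Point
  symmetricWalk A u₁ u₂ = walk A 0# A u₁ u₂ (- u₁) (- u₂)

  -- t times the 3 × 3 minors of the matrix with rows (1,1,1,1), (0,a,b,c), (0,a²,b²,c²).
  kernel : (t a b c : Carrier) → Fin 4 → Carrier
  kernel t a b c 0F = t * (c - b) * (a - c) * (b - a)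
  kernel t a b c 1F = t * b * c * (c - b)
  kernel t a b c 2F = t * a * c * (a - c)
  kernel t a b c 3F = t * a * b * (b - a)

  kernelWalk : (t a b c : Carrier) → Point
  kernelWalk t a b c = walk a b c (kernel t a b c 0F) (kernel t a b c 1F) (kernel t a b c 2F) (kernel t a b c 3F)

module _ {q : ℕ} (F : FiniteField q) where
  open FiniteField F
  open Lambda F

  rawRing : RawRing 0ℓ 0ℓ
  rawRing = record { Carrier = Carrier ; _≈_ = _≡_ ; _+_ = _+_ ; _*_ = _*_ ; -_ = -_ ; 0# = 0# ; 1# = 1# }

  open IntegerCoefficientSolver rawRing isCommutativeRing

  exprRing : ℕ → RawRing 0ℓ 0ℓ
  exprRing n = record
    { Carrier = Expr ℤ n ; _≈_ = _≡_ ; _+_ = _⊕_ ; _*_ = _⊗_ ; -_ = ⊝_ ; 0# = :0 ; 1# = :1 }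

  open RawRingWalk rawRing using (Point; point; origin; step; walk₁; walk₂; walk₃; walk; symmetricWalk; kernel; kernelWalk)
  module Syntax {n : ℕ} = RawRingWalk (exprRing n)

  commutativeRing : CommutativeRing 0ℓ 0ℓ
  commutativeRing = record { isCommutativeRing = isCommutativeRing }

  open CommutativeRing commutativeRing
    using (+-comm; +-identityˡ; +-identityʳ; -‿inverseʳ; *-comm; *-assoc; *-identityʳ; zeroˡ; +-group)
  open import Algebra.Properties.Group +-group
    using (x∙y⁻¹≈ε⇒x≈y; x≈y⇒x∙y⁻¹≈ε; inverseʳ-unique; ε⁻¹≈ε; ⁻¹-injective)
    renaming (∙-cancelˡ to +-cancelˡ; ∙-cancelʳ to +-cancelʳ)

  infix 4 _≟_
  _≟_ : (x y : Carrier) → Dec (x ≡ y)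
  x ≟ y with Inverse.to enum x Finₚ.≟ Inverse.to enum y
  ... | yes p = yes (Injection.injective (↔⇒↣ enum) p)
  ... | no ¬p = no (¬p ∘ cong (Inverse.to enum))

  1≢0 : 1# ≢ 0#
  1≢0 = 0≢1 ∘ sym

  x-y≡0⇒x≡y : ∀ {x y} → x - y ≡ 0# → x ≡ y
  x-y≡0⇒x≡y = x∙y⁻¹≈ε⇒x≈y _ _

  x≢y⇒x-y≢0 : ∀ {x y} → x ≢ y → x - y ≢ 0#
  x≢y⇒x-y≢0 x≢y = x≢y ∘ x-y≡0⇒x≡y

  x-z≡y-z⇒x≡y : ∀ {x y z} → x - z ≡ y - z → x ≡ y
  x-z≡y-z⇒x≡y = +-cancelʳ _ _ _

  differ-by : ∀ {x y z} → y - x ≡ z → z ≢ 0# → x ≢ y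
  differ-by y-x≡z z≢0 x≡y = z≢0 (trans (sym y-x≡z) (x≈y⇒x∙y⁻¹≈ε (sym x≡y)))

  x+y≡0⇒y≡-x : ∀ {x y} → x + y ≡ 0# → y ≡ - x
  x+y≡0⇒y≡-x = inverseʳ-unique _ _

  -x≡0⇒x≡0 : ∀ {x} → - x ≡ 0# → x ≡ 0#
  -x≡0⇒x≡0 -x≡0 = ⁻¹-injective (trans -x≡0 (sym ε⁻¹≈ε))

  -x≢0 : ∀ {x} → x ≢ 0# → - x ≢ 0#
  -x≢0 x≢0 = x≢0 ∘ -x≡0⇒x≡0

  a+p≡c⇒p≡c-a : ∀ {a p c} → a + p ≡ c → p ≡ c - a
  a+p≡c⇒p≡c-a {a} {p} e = trans (solve 2 (λ a p → p := a :+ p :- a) refl a p) (cong (_- a) e)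

  b≡a+[b-a] : ∀ a b → b ≡ a + (b - a)
  b≡a+[b-a] = solve 2 (λ a b → b := a :+ (b :- a)) refl

  x*y≡0∧y≢0⇒x≡0 : ∀ {x y} → x * y ≡ 0# → y ≢ 0# → x ≡ 0#
  x*y≡0∧y≢0⇒x≡0 {x} {y} xy≡0 y≢0 with inverse y y≢0
  ... | y⁻¹ , yy⁻¹≡1 = begin
    x             ≡⟨ sym (*-identityʳ x) ⟩
    x * 1#        ≡⟨ cong (x *_) (sym yy⁻¹≡1) ⟩
    x * (y * y⁻¹) ≡⟨ sym (*-assoc x y y⁻¹) ⟩
    x * y * y⁻¹   ≡⟨ cong (_* y⁻¹) xy≡0 ⟩
    0# * y⁻¹      ≡⟨ zeroˡ y⁻¹ ⟩
    0#            ∎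
    where open ≡-Reasoning

  x*y≡0∧x≢0⇒y≡0 : ∀ {x y} → x * y ≡ 0# → x ≢ 0# → y ≡ 0#
  x*y≡0∧x≢0⇒y≡0 xy≡0 = x*y≡0∧y≢0⇒x≡0 (trans (*-comm _ _) xy≡0)

  infixl 7 _·≢0_
  _·≢0_ : ∀ {x y} → x ≢ 0# → y ≢ 0# → x * y ≢ 0#
  (x≢0 ·≢0 y≢0) xy≡0 = x≢0 (x*y≡0∧y≢0⇒x≡0 xy≡0 y≢0)

  *-cancelˡ : ∀ {c x y} → c ≢ 0# → c * x ≡ c * y → x ≡ y
  *-cancelˡ {c} {x} {y} c≢0 cx≡cy = x-y≡0⇒x≡y (x*y≡0∧x≢0⇒y≡0 (trans
    (solve 3 (λ c x y → c :* (x :- y) := c :* x :- c :* y) refl c x y) (x≈y⇒x∙y⁻¹≈ε cx≡cy)) c≢0)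

  cong₃ : ∀ {B : Set} (f : Carrier → Carrier → Carrier → B) {a a' b b' c c'} →
          a ≡ a' → b ≡ b' → c ≡ c' → f a b c ≡ f a' b' c'
  cong₃ f refl refl refl = refl

  at-ext : ∀ {n} (v w : Vec Carrier n) → (∀ i → at v i ≡ at w i) → v ≡ w
  at-ext []      []      _  = refl
  at-ext (x ∷ v) (y ∷ w) eq = cong₂ _∷_ (eq 0) (at-ext v w (eq ∘ suc))

  at-beyond : ∀ {n} (v : Vec Carrier n) i → n ≤ i → at v i ≡ 0#
  at-beyond []      i       _         = refl
  at-beyond (x ∷ v) (suc i) (s≤s n≤i) = at-beyond v i n≤i

  2≤2+ : ∀ {i} → 2 ≤ suc (suc i)
  2≤2+ = s≤s (s≤s z≤n)

  -- Coordinates i and i + 1 agree, by induction on i: the equation for coordinate i + 2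
  -- fixes it from coordinate i.
  R-unique : ∀ {k} l (r r' : V k) → Adj k l r → Adj k l r' → InR r → InR r' → at r 0 ≡ at r' 0 → r ≡ r'
  R-unique {k} l r r' adj adj' r∈R r'∈R y≡y' = at-ext r r' (proj₁ ∘ agree)
    where
    agree : ∀ i → at r i ≡ at r' i × at r (suc i) ≡ at r' (suc i)
    agree zero = y≡y' , trans r∈R (sym r'∈R)
    agree (suc i) with agree i | suc (suc i) ℕ.≤? k
    ... | eq , eq₁ | yes j≤k = eq₁ , +-cancelˡ (at l (suc (suc i))) _ _
      (trans (adj _ 2≤2+ j≤k)
        (trans (cong₂ (λ y z → if phase23 (suc (suc i)) then y * at l i else at l 0 * z) y≡y' eq)
          (sym (adj' _ 2≤2+ j≤k))))
    ... | _  , eq₁ | no  j≰k =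
      eq₁ , trans (at-beyond r _ (ℕₚ.≰⇒> j≰k)) (sym (at-beyond r' _ (ℕₚ.≰⇒> j≰k)))

  L-unique : ∀ {k} (l l' r : V k) → 2 ≤ k → Adj k l r → Adj k l' r → InL l → InL l' → at l 0 ≡ at l' 0 → l ≡ l'
  L-unique {k} l l' r 2≤k adj adj' l∈L l'∈L x≡x' = at-ext l l' (proj₁ ∘ agree)
    where
    b≡b' : at l 2 ≡ at l' 2
    b≡b' = +-cancelʳ (at r 2) _ _ (trans (adj 2 2≤2+ 2≤k) (trans (cong (at r 0 *_) x≡x') (sym (adj' 2 2≤2+ 2≤k))))
    agree : ∀ i → at l i ≡ at l' i × at l (suc i) ≡ at l' (suc i)
    agree zero = x≡x' , trans l∈L (trans b≡b' (sym l'∈L))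
    agree (suc i) with agree i | suc (suc i) ℕ.≤? k
    ... | eq , eq₁ | yes j≤k = eq₁ , +-cancelʳ (at r (suc (suc i))) _ _
      (trans (adj _ 2≤2+ j≤k)
        (trans (cong₂ (λ z x → if phase23 (suc (suc i)) then at r 0 * z else x * at r i) eq x≡x')
          (sym (adj' _ 2≤2+ j≤k))))
    ... | _  , eq₁ | no  j≰k =
      eq₁ , trans (at-beyond l _ (ℕₚ.≰⇒> j≰k)) (sym (at-beyond l' _ (ℕₚ.≰⇒> j≰k)))

  b+p≡yx∧b'+p≡yx'⇒b'≡b+y[x'-x] : ∀ {b b' p y x x'} → b + p ≡ y * x → b' + p ≡ y * x' → b' ≡ b + y * (x' - x)
  b+p≡yx∧b'+p≡yx'⇒b'≡b+y[x'-x] {b} {b'} {p} {y} {x} {x'} e e' = begin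
    b'                     ≡⟨ solve 3 (λ b b' p → b' := (b' :+ p) :- (b :+ p) :+ b) refl b b' p ⟩
    (b' + p) - (b + p) + b ≡⟨ cong₂ (λ s t → s - t + b) e' e ⟩
    y * x' - y * x + b     ≡⟨ solve 4 (λ b y x x' → y :* x' :- y :* x :+ b := b :+ y :* (x' :- x)) refl b y x x' ⟩
    b + y * (x' - x)       ∎
    where open ≡-Reasoning

  common-neighbour : ∀ {k} (l l' r : V k) → Adj k l r → Adj k l' r → ∀ i → 2 ≤ i → i ≤ k →
    at l' i ≡ at l i + (if phase23 i then at r 0 * (at l' (i ∸ 2) - at l (i ∸ 2))
                                     else at r (i ∸ 2) * (at l' 0 - at l 0))
  common-neighbour l l' r adj adj' i 2≤i i≤k with phase23 i | adj i 2≤i i≤k | adj' i 2≤i i≤k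
  ... | true  | e | e' = b+p≡yx∧b'+p≡yx'⇒b'≡b+y[x'-x] e e'
  ... | false | e | e' = b+p≡yx∧b'+p≡yx'⇒b'≡b+y[x'-x] (trans e (*-comm _ _)) (trans e' (*-comm _ _))

  module _ {k} (l l' r : V k) (adj : Adj k l r) (adj' : Adj k l' r) where

    neighbour-b : 2 ≤ k → at l' 2 ≡ at l 2 + at r 0 * (at l' 0 - at l 0)
    neighbour-b 2≤k = common-neighbour l l' r adj adj' 2 2≤2+ 2≤k

    neighbour-c : 3 ≤ k → InL l → InL l' → at l' 3 ≡ at l 3 + at r 0 * (at l' 2 - at l 2)
    neighbour-c 3≤k l∈L l'∈L = trans (common-neighbour l l' r adj adj' 3 2≤2+ 3≤k)
      (cong₂ (λ s t → at l 3 + at r 0 * (s - t)) l'∈L l∈L)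

    neighbour-d : 4 ≤ k → at l' 4 ≡ at l 4 + (at r 0 * at l 0 - at l 2) * (at l' 0 - at l 0)
    neighbour-d 4≤k = trans (common-neighbour l l' r adj adj' 4 2≤2+ 4≤k)
      (cong (λ p → at l 4 + p * (at l' 0 - at l 0)) (a+p≡c⇒p≡c-a (adj 2 2≤2+ (ℕₚ.≤-trans 2≤2+ 4≤k))))

    neighbour-e : 5 ≤ k → InL l → at l' 5 ≡ at l 5 + (at r 0 * at l 2 - at l 3) * (at l' 0 - at l 0)
    neighbour-e 5≤k l∈L = trans (common-neighbour l l' r adj adj' 5 2≤2+ 5≤k)
      (cong (λ p → at l 5 + p * (at l' 0 - at l 0))
        (trans (a+p≡c⇒p≡c-a (adj 3 2≤2+ (ℕₚ.≤-trans (s≤s 2≤2+) 5≤k)))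
          (cong (λ z → at r 0 * z - at l 3) l∈L)))

  -- A closed walk l₀ r₀ l₁ r₁ … l₀ without immediate backtracking, read from an L-vertex.
  record Cycle (k n : ℕ) : Set where
    field
      l r    : Fin n → V k
      l∈L    : ∀ i → InL (l i)
      r∈R    : ∀ i → InR (r i)
      adj-lr : ∀ i → Adj k (l i) (r i)
      adj-rl : ∀ i → Adj k (l (next i)) (r i)
      l-step : ∀ i → l i ≢ l (next i)
      r-step : ∀ i → r i ≢ r (next i)

    x y : Fin n → Carrier
    x i = at (l i) 0
    y i = at (r i) 0

    Δx≢0 : 2 ≤ k → ∀ i → x (next i) - x i ≢ 0#
    Δx≢0 2≤k i Δx≡0 = l-step i (L-unique (l i) (l (next i)) (r i) 2≤k (adj-lr i) (adj-rl i)
      (l∈L i) (l∈L (next i)) (sym (x-y≡0⇒x≡y Δx≡0)))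

    y-next≢y : ∀ i → y (next i) ≢ y i
    y-next≢y i y'≡y = r-step i (R-unique (l (next i)) (r i) (r (next i)) (adj-rl i) (adj-lr (next i))
      (r∈R i) (r∈R (next i)) (sym y'≡y))

    b-step : 2 ≤ k → ∀ i → at (l (next i)) 2 ≡ at (l i) 2 + y i * (x (next i) - x i)
    b-step 2≤k i = neighbour-b (l i) (l (next i)) (r i) (adj-lr i) (adj-rl i) 2≤k

    c-step : 3 ≤ k → ∀ i → at (l (next i)) 3 ≡ at (l i) 3 + y i * (at (l (next i)) 2 - at (l i) 2)
    c-step 3≤k i = neighbour-c (l i) (l (next i)) (r i) (adj-lr i) (adj-rl i) 3≤k (l∈L i) (l∈L (next i))

    d-step : 4 ≤ k → ∀ i → at (l (next i)) 4 ≡ at (l i) 4 + (y i * x i - at (l i) 2) * (x (next i) - x i)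
    d-step 4≤k i = neighbour-d (l i) (l (next i)) (r i) (adj-lr i) (adj-rl i) 4≤k

    e-step : 5 ≤ k → ∀ i → at (l (next i)) 5 ≡ at (l i) 5 + (y i * at (l i) 2 - at (l i) 3) * (x (next i) - x i)
    e-step 5≤k i = neighbour-e (l i) (l (next i)) (r i) (adj-lr i) (adj-rl i) 5≤k (l∈L i)

  quadrilateral-closure : ∀ x₁ x₂ y₁ y₂ b₁ b₂ →
    b₂ ≡ b₁ + y₁ * (x₂ - x₁) → b₁ ≡ b₂ + y₂ * (x₁ - x₂) → (y₁ - y₂) * (x₂ - x₁) ≡ 0#
  quadrilateral-closure x₁ x₂ y₁ y₂ b₁ _ refl b-closes = trans
    (solve 5 (λ x₁ x₂ y₁ y₂ b₁ → (y₁ :- y₂) :* (x₂ :- x₁) := (b₁ :+ y₁ :* (x₂ :- x₁) :+ y₂ :* (x₁ :- x₂)) :- b₁)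
      refl x₁ x₂ y₁ y₂ b₁)
    (x≈y⇒x∙y⁻¹≈ε (sym b-closes))

  hexagon-closure : ∀ x₁ x₂ x₃ y₁ y₂ y₃ b₁ b₂ b₃ c₁ c₂ c₃ →
    b₂ ≡ b₁ + y₁ * (x₂ - x₁) → b₃ ≡ b₂ + y₂ * (x₃ - x₂) → b₁ ≡ b₃ + y₃ * (x₁ - x₃) →
    c₂ ≡ c₁ + y₁ * (b₂ - b₁) → c₃ ≡ c₂ + y₂ * (b₃ - b₂) → c₁ ≡ c₃ + y₃ * (b₁ - b₃) →
    (x₂ - x₁) * (y₁ - y₃) * (y₂ - y₁) ≡ 0#
  hexagon-closure x₁ x₂ x₃ y₁ y₂ y₃ b₁ _ _ c₁ _ _ refl refl b-closes refl refl c-closes = trans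
    (solve 8 (λ x₁ x₂ x₃ y₁ y₂ y₃ b₁ c₁ →
      let b₂ = b₁ :+ y₁ :* (x₂ :- x₁)
          b₃ = b₂ :+ y₂ :* (x₃ :- x₂)
          c₃ = c₁ :+ y₁ :* (b₂ :- b₁) :+ y₂ :* (b₃ :- b₂)
      in (x₂ :- x₁) :* (y₁ :- y₃) :* (y₂ :- y₁)
         := y₂ :* (b₃ :+ y₃ :* (x₁ :- x₃) :- b₁) :- (c₃ :+ y₃ :* (b₁ :- b₃) :- c₁))
      refl x₁ x₂ x₃ y₁ y₂ y₃ b₁ c₁)
    (trans (cong₂ (λ p r → y₂ * p - r) (x≈y⇒x∙y⁻¹≈ε (sym b-closes)) (x≈y⇒x∙y⁻¹≈ε (sym c-closes)))
      (solve 1 (λ y → y :* :0 :- :0 := :0) refl y₂))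

  no-quadrilateral : ∀ {k} → 2 ≤ k → ¬ Cycle k 2
  no-quadrilateral 2≤k C = (x≢y⇒x-y≢0 (y-next≢y 0F ∘ sym) ·≢0 Δx≢0 2≤k 0F)
    (quadrilateral-closure _ _ _ _ _ _ (b-step 2≤k 0F) (b-step 2≤k 1F))
    where open Cycle C

  no-hexagon : ∀ {k} → 3 ≤ k → ¬ Cycle k 3
  no-hexagon 3≤k C = (Δx≢0 2≤k 0F ·≢0 x≢y⇒x-y≢0 (y-next≢y 2F) ·≢0 x≢y⇒x-y≢0 (y-next≢y 0F))
    (hexagon-closure _ _ _ _ _ _ _ _ _ _ _ _ (b-step 2≤k 0F) (b-step 2≤k 1F) (b-step 2≤k 2F)
      (c-step 3≤k 0F) (c-step 3≤k 1F) (c-step 3≤k 2F))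
    where
    open Cycle C
    2≤k : 2 ≤ _
    2≤k = ℕₚ.≤-trans 2≤2+ 3≤k

  -- Closing equations of an 8-cycle l₁ r₁ … l₄ r₄: xᵢ, yᵢ are the first coordinates of lᵢ, rᵢ
  -- and bᵢ, cᵢ, dᵢ, eᵢ coordinates 2 to 5 of lᵢ; the conclusions are stated for the walk
  -- shifted to start at the origin.
  module _ (x₁ x₂ x₃ x₄ y₁ y₂ y₃ y₄ : Carrier) where

    private
      U₁ U₂ U₃ U₄ A B C : Carrier
      U₁ = x₂ - x₁
      U₂ = x₃ - x₂
      U₃ = x₄ - x₃
      U₄ = x₁ - x₄
      A = y₂ - y₁
      B = y₃ - y₁
      C = y₄ - y₁

    octagon-closure-b : ∀ b₁ b₂ b₃ b₄ →
      b₂ ≡ b₁ + y₁ * U₁ → b₃ ≡ b₂ + y₂ * U₂ → b₄ ≡ b₃ + y₃ * U₃ → b₁ ≡ b₄ + y₄ * U₄ →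
      A * U₂ + B * U₃ + C * U₄ ≡ 0#
    octagon-closure-b b₁ _ _ _ refl refl refl b-closes = trans
      (solve 9 (λ x₁ x₂ x₃ x₄ y₁ y₂ y₃ y₄ b₁ →
        (y₂ :- y₁) :* (x₃ :- x₂) :+ (y₃ :- y₁) :* (x₄ :- x₃) :+ (y₄ :- y₁) :* (x₁ :- x₄)
        := (b₁ :+ y₁ :* (x₂ :- x₁) :+ y₂ :* (x₃ :- x₂) :+ y₃ :* (x₄ :- x₃) :+ y₄ :* (x₁ :- x₄)) :- b₁)
        refl x₁ x₂ x₃ x₄ y₁ y₂ y₃ y₄ b₁)
      (x≈y⇒x∙y⁻¹≈ε (sym b-closes))

    octagon-closure-c : ∀ b₁ b₂ b₃ b₄ c₁ c₂ c₃ c₄ →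
      b₂ ≡ b₁ + y₁ * U₁ → b₃ ≡ b₂ + y₂ * U₂ → b₄ ≡ b₃ + y₃ * U₃ → b₁ ≡ b₄ + y₄ * U₄ →
      c₂ ≡ c₁ + y₁ * (b₂ - b₁) → c₃ ≡ c₂ + y₂ * (b₃ - b₂) → c₄ ≡ c₃ + y₃ * (b₄ - b₃) → c₁ ≡ c₄ + y₄ * (b₁ - b₄) →
      A * A * U₂ + B * B * U₃ + C * C * U₄ ≡ 0#
    octagon-closure-c b₁ _ _ _ c₁ _ _ _ refl refl refl b-closes refl refl refl c-closes = trans
      (solve 10 (λ x₁ x₂ x₃ x₄ y₁ y₂ y₃ y₄ b₁ c₁ →
        let b₂ = b₁ :+ y₁ :* (x₂ :- x₁)
            b₃ = b₂ :+ y₂ :* (x₃ :- x₂)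
            b₄ = b₃ :+ y₃ :* (x₄ :- x₃)
            c₄ = c₁ :+ y₁ :* (b₂ :- b₁) :+ y₂ :* (b₃ :- b₂) :+ y₃ :* (b₄ :- b₃)
        in (y₂ :- y₁) :* (y₂ :- y₁) :* (x₃ :- x₂) :+ (y₃ :- y₁) :* (y₃ :- y₁) :* (x₄ :- x₃)
             :+ (y₄ :- y₁) :* (y₄ :- y₁) :* (x₁ :- x₄)
           := (c₄ :+ y₄ :* (b₁ :- b₄) :- c₁) :+ (y₄ :- (y₁ :+ y₁)) :* (b₄ :+ y₄ :* (x₁ :- x₄) :- b₁))
        refl x₁ x₂ x₃ x₄ y₁ y₂ y₃ y₄ b₁ c₁)
      (trans (cong₂ (λ p r → p + (y₄ - (y₁ + y₁)) * r) (x≈y⇒x∙y⁻¹≈ε (sym c-closes)) (x≈y⇒x∙y⁻¹≈ε (sym b-closes)))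
        (solve 2 (λ y₁ y₄ → :0 :+ (y₄ :- (y₁ :+ y₁)) :* :0 := :0) refl y₁ y₄))

    octagon-closure-d : ∀ b₁ b₂ b₃ b₄ d₁ d₂ d₃ d₄ →
      b₂ ≡ b₁ + y₁ * U₁ → b₃ ≡ b₂ + y₂ * U₂ → b₄ ≡ b₃ + y₃ * U₃ → b₁ ≡ b₄ + y₄ * U₄ →
      d₂ ≡ d₁ + (y₁ * x₁ - b₁) * U₁ → d₃ ≡ d₂ + (y₂ * x₂ - b₂) * U₂ →
      d₄ ≡ d₃ + (y₃ * x₃ - b₃) * U₃ → d₁ ≡ d₄ + (y₄ * x₄ - b₄) * U₄ →
      Point.d (walk A B C U₁ U₂ U₃ U₄) ≡ 0#
    octagon-closure-d b₁ _ _ _ d₁ _ _ _ refl refl refl b-closes refl refl refl d-closes = trans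
      (solve 10 (λ x₁ x₂ x₃ x₄ y₁ y₂ y₃ y₄ b₁ d₁ →
        let b₂ = b₁ :+ y₁ :* (x₂ :- x₁)
            b₃ = b₂ :+ y₂ :* (x₃ :- x₂)
            b₄ = b₃ :+ y₃ :* (x₄ :- x₃)
            d₄ = d₁ :+ (y₁ :* x₁ :- b₁) :* (x₂ :- x₁) :+ (y₂ :* x₂ :- b₂) :* (x₃ :- x₂) :+ (y₃ :* x₃ :- b₃) :* (x₄ :- x₃)
        in Syntax.Point.d (Syntax.walk (y₂ :- y₁) (y₃ :- y₁) (y₄ :- y₁) (x₂ :- x₁) (x₃ :- x₂) (x₄ :- x₃) (x₁ :- x₄))
           := (d₄ :+ (y₄ :* x₄ :- b₄) :* (x₁ :- x₄) :- d₁) :- x₁ :* (b₄ :+ y₄ :* (x₁ :- x₄) :- b₁))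
        refl x₁ x₂ x₃ x₄ y₁ y₂ y₃ y₄ b₁ d₁)
      (trans (cong₂ (λ p r → p - x₁ * r) (x≈y⇒x∙y⁻¹≈ε (sym d-closes)) (x≈y⇒x∙y⁻¹≈ε (sym b-closes)))
        (solve 1 (λ x₁ → :0 :- x₁ :* :0 := :0) refl x₁))

    octagon-closure-e : ∀ b₁ b₂ b₃ b₄ c₁ c₂ c₃ c₄ d₁ d₂ d₃ d₄ e₁ e₂ e₃ e₄ →
      b₂ ≡ b₁ + y₁ * U₁ → b₃ ≡ b₂ + y₂ * U₂ → b₄ ≡ b₃ + y₃ * U₃ → b₁ ≡ b₄ + y₄ * U₄ →
      c₂ ≡ c₁ + y₁ * (b₂ - b₁) → c₃ ≡ c₂ + y₂ * (b₃ - b₂) → c₄ ≡ c₃ + y₃ * (b₄ - b₃) →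
      d₂ ≡ d₁ + (y₁ * x₁ - b₁) * U₁ → d₃ ≡ d₂ + (y₂ * x₂ - b₂) * U₂ →
      d₄ ≡ d₃ + (y₃ * x₃ - b₃) * U₃ → d₁ ≡ d₄ + (y₄ * x₄ - b₄) * U₄ →
      e₂ ≡ e₁ + (y₁ * b₁ - c₁) * U₁ → e₃ ≡ e₂ + (y₂ * b₂ - c₂) * U₂ →
      e₄ ≡ e₃ + (y₃ * b₃ - c₃) * U₃ → e₁ ≡ e₄ + (y₄ * b₄ - c₄) * U₄ →
      Point.e (walk A B C U₁ U₂ U₃ U₄) ≡ 0#
    octagon-closure-e b₁ _ _ _ c₁ _ _ _ d₁ _ _ _ e₁ _ _ _
      refl refl refl b-closes refl refl refl refl refl refl d-closes refl refl refl e-closes = trans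
      (solve 12 (λ x₁ x₂ x₃ x₄ y₁ y₂ y₃ y₄ b₁ c₁ d₁ e₁ →
        let b₂ = b₁ :+ y₁ :* (x₂ :- x₁)
            b₃ = b₂ :+ y₂ :* (x₃ :- x₂)
            b₄ = b₃ :+ y₃ :* (x₄ :- x₃)
            c₂ = c₁ :+ y₁ :* (b₂ :- b₁)
            c₃ = c₂ :+ y₂ :* (b₃ :- b₂)
            c₄ = c₃ :+ y₃ :* (b₄ :- b₃)
            d₄ = d₁ :+ (y₁ :* x₁ :- b₁) :* (x₂ :- x₁) :+ (y₂ :* x₂ :- b₂) :* (x₃ :- x₂) :+ (y₃ :* x₃ :- b₃) :* (x₄ :- x₃)
            e₄ = e₁ :+ (y₁ :* b₁ :- c₁) :* (x₂ :- x₁) :+ (y₂ :* b₂ :- c₂) :* (x₃ :- x₂) :+ (y₃ :* b₃ :- c₃) :* (x₄ :- x₃)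
        in Syntax.Point.e (Syntax.walk (y₂ :- y₁) (y₃ :- y₁) (y₄ :- y₁) (x₂ :- x₁) (x₃ :- x₂) (x₄ :- x₃) (x₁ :- x₄))
           := (e₄ :+ (y₄ :* b₄ :- c₄) :* (x₁ :- x₄) :- e₁)
              :- (b₁ :- x₁ :* y₁) :* (b₄ :+ y₄ :* (x₁ :- x₄) :- b₁)
              :- y₁ :* (d₄ :+ (y₄ :* x₄ :- b₄) :* (x₁ :- x₄) :- d₁))
        refl x₁ x₂ x₃ x₄ y₁ y₂ y₃ y₄ b₁ c₁ d₁ e₁)
      (trans (cong₂ (λ p s → p - s) (cong₂ (λ p r → p - (b₁ - x₁ * y₁) * r) (x≈y⇒x∙y⁻¹≈ε (sym e-closes)) (x≈y⇒x∙y⁻¹≈ε (sym b-closes)))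
                                     (cong (y₁ *_) (x≈y⇒x∙y⁻¹≈ε (sym d-closes))))
        (solve 3 (λ b₁ x₁ y₁ → :0 :- (b₁ :- x₁ :* y₁) :* :0 :- y₁ :* :0 := :0) refl b₁ x₁ y₁))

  -- The two possible shapes of the increments u₁, …, u₄ of an 8-cycle whose R-vertices
  -- have first coordinates 0, A, B, C.
  Symmetric : (u₁ u₂ u₃ u₄ A B C : Carrier) → Set
  Symmetric u₁ u₂ u₃ u₄ A B C = B ≡ 0# × C ≡ A × u₃ ≡ - u₁ × u₄ ≡ - u₂

  Vandermonde : (u₁ u₂ u₃ u₄ A B C : Carrier) → Set
  Vandermonde u₁ u₂ u₃ u₄ A B C = B ≢ 0# × A ≢ C × Σ Carrier λ t → t ≢ 0# ×
    u₁ ≡ kernel t A B C 0F × u₂ ≡ kernel t A B C 1F × u₃ ≡ kernel t A B C 2F × u₄ ≡ kernel t A B C 3F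

  private
    symmetric-tail : ∀ u₁ u₂ u₃ u₄ A → u₁ + u₂ + u₃ + u₄ ≡ 0# → A * u₂ + 0# * u₃ + A * u₄ ≡ 0# → A ≢ 0# →
                     u₃ ≡ - u₁ × u₄ ≡ - u₂
    symmetric-tail u₁ u₂ u₃ u₄ A Σu≡0 moment₁ A≢0 = x+y≡0⇒y≡-x u₁+u₃≡0 , x+y≡0⇒y≡-x u₂+u₄≡0
      where
      u₂+u₄≡0 : u₂ + u₄ ≡ 0#
      u₂+u₄≡0 = x*y≡0∧x≢0⇒y≡0
        (trans (solve 4 (λ u₂ u₃ u₄ A → A :* (u₂ :+ u₄) := A :* u₂ :+ :0 :* u₃ :+ A :* u₄) refl u₂ u₃ u₄ A) moment₁) A≢0
      u₁+u₃≡0 : u₁ + u₃ ≡ 0#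
      u₁+u₃≡0 = trans (solve 4 (λ u₁ u₂ u₃ u₄ → u₁ :+ u₃ := (u₁ :+ u₂ :+ u₃ :+ u₄) :- (u₂ :+ u₄)) refl u₁ u₂ u₃ u₄)
        (trans (cong₂ _-_ Σu≡0 u₂+u₄≡0) (solve 0 (:0 :- :0 := :0) refl))

    -- W = B C (C - B) is invertible; t = u₂ / W, and the other u's are read off the two moments.
    vandermonde-tail : ∀ u₁ u₂ u₃ u₄ A B C → u₁ + u₂ + u₃ + u₄ ≡ 0# →
      A * u₂ + B * u₃ + C * u₄ ≡ 0# → A * A * u₂ + B * B * u₃ + C * C * u₄ ≡ 0# →
      u₂ ≢ 0# → B * C * (C - B) ≢ 0# →
      Σ Carrier λ t → t ≢ 0# × u₁ ≡ kernel t A B C 0F × u₂ ≡ kernel t A B C 1F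
                             × u₃ ≡ kernel t A B C 2F × u₄ ≡ kernel t A B C 3F
    vandermonde-tail u₁ u₂ u₃ u₄ A B C Σu≡0 moment₁ moment₂ u₂≢0 W≢0 with inverse (B * C * (C - B)) W≢0
    ... | w , Ww≡1 = t , t≢0 , u₁≡ , u₂≡ , u₃≡ , u₄≡
      where
      open ≡-Reasoning
      t : Carrier
      t = u₂ * w
      u₂≡ : u₂ ≡ t * B * C * (C - B)
      u₂≡ = sym (begin
        u₂ * w * B * C * (C - B)   ≡⟨ solve 4 (λ u₂ w B C → u₂ :* w :* B :* C :* (C :- B) := u₂ :* (B :* C :* (C :- B) :* w)) refl u₂ w B C ⟩
        u₂ * (B * C * (C - B) * w) ≡⟨ cong (u₂ *_) Ww≡1 ⟩
        u₂ * 1#                    ≡⟨ *-identityʳ u₂ ⟩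
        u₂                         ∎)
      t≢0 : t ≢ 0#
      t≢0 t≡0 = u₂≢0 (trans u₂≡ (trans (cong (λ z → z * B * C * (C - B)) t≡0)
        (solve 2 (λ B C → :0 :* B :* C :* (C :- B) := :0) refl B C)))
      u₃≡ : u₃ ≡ t * A * C * (A - C)
      u₃≡ = *-cancelˡ W≢0 (begin
        B * C * (C - B) * u₃
          ≡⟨ solve 6 (λ u₂ u₃ u₄ A B C → B :* C :* (C :- B) :* u₃
               := A :* C :* (A :- C) :* u₂ :+ (C :* C :* (A :* u₂ :+ B :* u₃ :+ C :* u₄)
                                              :- C :* (A :* A :* u₂ :+ B :* B :* u₃ :+ C :* C :* u₄)))
               refl u₂ u₃ u₄ A B C ⟩
        A * C * (A - C) * u₂ + (C * C * (A * u₂ + B * u₃ + C * u₄) - C * (A * A * u₂ + B * B * u₃ + C * C * u₄))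
          ≡⟨ cong₃ (λ p r z → A * C * (A - C) * z + (C * C * p - C * r)) moment₁ moment₂ u₂≡ ⟩
        A * C * (A - C) * (t * B * C * (C - B)) + (C * C * 0# - C * 0#)
          ≡⟨ solve 4 (λ t A B C → A :* C :* (A :- C) :* (t :* B :* C :* (C :- B)) :+ (C :* C :* :0 :- C :* :0)
               := B :* C :* (C :- B) :* (t :* A :* C :* (A :- C))) refl t A B C ⟩
        B * C * (C - B) * (t * A * C * (A - C)) ∎)
      u₄≡ : u₄ ≡ t * A * B * (B - A)
      u₄≡ = *-cancelˡ W≢0 (begin
        B * C * (C - B) * u₄
          ≡⟨ solve 6 (λ u₂ u₃ u₄ A B C → B :* C :* (C :- B) :* u₄
               := A :* B :* (B :- A) :* u₂ :+ (B :* (A :* A :* u₂ :+ B :* B :* u₃ :+ C :* C :* u₄)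
                                              :- B :* B :* (A :* u₂ :+ B :* u₃ :+ C :* u₄)))
               refl u₂ u₃ u₄ A B C ⟩
        A * B * (B - A) * u₂ + (B * (A * A * u₂ + B * B * u₃ + C * C * u₄) - B * B * (A * u₂ + B * u₃ + C * u₄))
          ≡⟨ cong₃ (λ r p z → A * B * (B - A) * z + (B * r - B * B * p)) moment₂ moment₁ u₂≡ ⟩
        A * B * (B - A) * (t * B * C * (C - B)) + (B * 0# - B * B * 0#)
          ≡⟨ solve 4 (λ t A B C → A :* B :* (B :- A) :* (t :* B :* C :* (C :- B)) :+ (B :* :0 :- B :* B :* :0)
               := B :* C :* (C :- B) :* (t :* A :* B :* (B :- A))) refl t A B C ⟩
        B * C * (C - B) * (t * A * B * (B - A)) ∎)
      u₁≡ : u₁ ≡ t * (C - B) * (A - C) * (B - A)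
      u₁≡ = begin
        u₁ ≡⟨ solve 4 (λ u₁ u₂ u₃ u₄ → u₁ := (u₁ :+ u₂ :+ u₃ :+ u₄) :- (u₂ :+ u₃ :+ u₄)) refl u₁ u₂ u₃ u₄ ⟩
        (u₁ + u₂ + u₃ + u₄) - (u₂ + u₃ + u₄)
          ≡⟨ cong₂ _-_ Σu≡0 (cong₃ (λ p r s → p + r + s) u₂≡ u₃≡ u₄≡) ⟩
        0# - (t * B * C * (C - B) + t * A * C * (A - C) + t * A * B * (B - A))
          ≡⟨ solve 4 (λ t A B C → :0 :- (t :* B :* C :* (C :- B) :+ t :* A :* C :* (A :- C) :+ t :* A :* B :* (B :- A))
               := t :* (C :- B) :* (A :- C) :* (B :- A)) refl t A B C ⟩
        t * (C - B) * (A - C) * (B - A) ∎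

  symmetric-or-vandermonde : ∀ u₁ u₂ u₃ u₄ A B C → u₁ + u₂ + u₃ + u₄ ≡ 0# →
    A * u₂ + B * u₃ + C * u₄ ≡ 0# → A * A * u₂ + B * B * u₃ + C * C * u₄ ≡ 0# →
    u₂ ≢ 0# → u₃ ≢ 0# → A ≢ 0# → C ≢ 0# → B ≢ A → C ≢ B →
    Symmetric u₁ u₂ u₃ u₄ A B C ⊎ Vandermonde u₁ u₂ u₃ u₄ A B C
  symmetric-or-vandermonde u₁ u₂ u₃ u₄ A B C Σu≡0 moment₁ moment₂ u₂≢0 u₃≢0 A≢0 C≢0 B≢A C≢B with B ≟ 0#
  ... | yes refl = inj₁ (refl , C≡A , symmetric-tail u₁ u₂ u₃ u₄ A Σu≡0 (subst (λ z → A * u₂ + 0# * u₃ + z * u₄ ≡ 0#) C≡A moment₁) A≢0)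
    where
    C≡A : C ≡ A
    C≡A = sym (x-y≡0⇒x≡y (x*y≡0∧x≢0⇒y≡0 (trans
      (solve 5 (λ u₂ u₃ u₄ A C → A :* u₂ :* (A :- C) := (A :* A :* u₂ :+ :0 :* :0 :* u₃ :+ C :* C :* u₄) :- C :* (A :* u₂ :+ :0 :* u₃ :+ C :* u₄))
        refl u₂ u₃ u₄ A C)
      (trans (cong₂ (λ p r → p - C * r) moment₂ moment₁) (solve 1 (λ C → :0 :- C :* :0 := :0) refl C)))
      (A≢0 ·≢0 u₂≢0)))
  ... | no B≢0 with A ≟ C
  ... | yes refl = ⊥-elim ((B≢0 ·≢0 u₃≢0 ·≢0 x≢y⇒x-y≢0 B≢A) (trans
      (solve 5 (λ u₂ u₃ u₄ A B → B :* u₃ :* (B :- A) := (A :* A :* u₂ :+ B :* B :* u₃ :+ A :* A :* u₄) :- A :* (A :* u₂ :+ B :* u₃ :+ A :* u₄))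
        refl u₂ u₃ u₄ A B)
      (trans (cong₂ (λ p r → p - A * r) moment₂ moment₁) (solve 1 (λ A → :0 :- A :* :0 := :0) refl A))))
  ... | no A≢C = inj₂ (B≢0 , A≢C , vandermonde-tail u₁ u₂ u₃ u₄ A B C Σu≡0 moment₁ moment₂ u₂≢0
      (B≢0 ·≢0 C≢0 ·≢0 x≢y⇒x-y≢0 C≢B))

  Closes₃ : Point → Set
  Closes₃ P = Point.x P ≡ 0# × Point.b P ≡ 0# × Point.c P ≡ 0#

  symmetricWalk-closes₃ : ∀ A u₁ u₂ → Closes₃ (symmetricWalk A u₁ u₂)
  symmetricWalk-closes₃ A u₁ u₂ =
    solve 3 (λ A u₁ u₂ → Syntax.Point.x (Syntax.symmetricWalk A u₁ u₂) := :0) refl A u₁ u₂ ,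
    solve 3 (λ A u₁ u₂ → Syntax.Point.b (Syntax.symmetricWalk A u₁ u₂) := :0) refl A u₁ u₂ ,
    solve 3 (λ A u₁ u₂ → Syntax.Point.c (Syntax.symmetricWalk A u₁ u₂) := :0) refl A u₁ u₂

  symmetricWalk-d : ∀ A u₁ u₂ → Point.d (symmetricWalk A u₁ u₂) ≡ (1# + 1#) * (A * u₁ * u₂)
  symmetricWalk-d = solve 3 (λ A u₁ u₂ → Syntax.Point.d (Syntax.symmetricWalk A u₁ u₂) := (:1 :+ :1) :* (A :* u₁ :* u₂)) refl

  symmetricWalk-e : ∀ A u₁ u₂ → Point.e (symmetricWalk A u₁ u₂) ≡ A * A * u₁ * u₂
  symmetricWalk-e = solve 3 (λ A u₁ u₂ → Syntax.Point.e (Syntax.symmetricWalk A u₁ u₂) := A :* A :* u₁ :* u₂) refl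

  kernelWalk-closes₃ : ∀ t a b c → Closes₃ (kernelWalk t a b c)
  kernelWalk-closes₃ t a b c =
    solve 4 (λ t a b c → Syntax.Point.x (Syntax.kernelWalk t a b c) := :0) refl t a b c ,
    solve 4 (λ t a b c → Syntax.Point.b (Syntax.kernelWalk t a b c) := :0) refl t a b c ,
    solve 4 (λ t a b c → Syntax.Point.c (Syntax.kernelWalk t a b c) := :0) refl t a b c

  kernelWalk-d : ∀ t a b c →
    Point.d (kernelWalk t a b c) ≡ - (t * t * a * b * c * (a - b) * (b - c) * (c - a) * (a + c - b))
  kernelWalk-d = solve 4 (λ t a b c → Syntax.Point.d (Syntax.kernelWalk t a b c)
    := :- (t :* t :* a :* b :* c :* (a :- b) :* (b :- c) :* (c :- a) :* (a :+ c :- b))) refl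

  kernelWalk-e : ∀ t a b c →
    Point.e (kernelWalk t a b c) ≡ - (t * t * a * a * b * c * c * (a - b) * (b - c) * (c - a))
  kernelWalk-e = solve 4 (λ t a b c → Syntax.Point.e (Syntax.kernelWalk t a b c)
    := :- (t :* t :* a :* a :* b :* c :* c :* (a :- b) :* (b :- c) :* (c :- a))) refl

  symmetricWalk-d≡0 : Char2 → ∀ A u₁ u₂ → Point.d (symmetricWalk A u₁ u₂) ≡ 0#
  symmetricWalk-d≡0 1+1≡0 A u₁ u₂ = trans (symmetricWalk-d A u₁ u₂) (trans (cong (_* (A * u₁ * u₂)) 1+1≡0) (zeroˡ _))

  kernelWalk-d≡0 : ∀ t a b c → a + c ≡ b → Point.d (kernelWalk t a b c) ≡ 0#
  kernelWalk-d≡0 t a b c a+c≡b = trans (kernelWalk-d t a b c)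
    (trans (cong (λ z → - (t * t * a * b * c * (a - b) * (b - c) * (c - a) * z)) (x≈y⇒x∙y⁻¹≈ε a+c≡b))
      (solve 1 (λ p → :- (p :* :0) := :0) refl (t * t * a * b * c * (a - b) * (b - c) * (c - a))))

  module _ {u₁ u₂ u₃ u₄ A B C : Carrier} where

    symmetric⇒char2 : Symmetric u₁ u₂ u₃ u₄ A B C → Point.d (walk A B C u₁ u₂ u₃ u₄) ≡ 0# →
                      A ≢ 0# → u₁ ≢ 0# → u₂ ≢ 0# → Char2
    symmetric⇒char2 (refl , refl , refl , refl) d≡0 A≢0 u₁≢0 u₂≢0 =
      x*y≡0∧y≢0⇒x≡0 (trans (sym (symmetricWalk-d A u₁ u₂)) d≡0) (A≢0 ·≢0 u₁≢0 ·≢0 u₂≢0)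

    symmetric⇒e≢0 : Symmetric u₁ u₂ u₃ u₄ A B C → A ≢ 0# → u₁ ≢ 0# → u₂ ≢ 0# →
                    Point.e (walk A B C u₁ u₂ u₃ u₄) ≢ 0#
    symmetric⇒e≢0 (refl , refl , refl , refl) A≢0 u₁≢0 u₂≢0 e≡0 =
      (A≢0 ·≢0 A≢0 ·≢0 u₁≢0 ·≢0 u₂≢0) (trans (sym (symmetricWalk-e A u₁ u₂)) e≡0)

    module _ (A≢0 : A ≢ 0#) (C≢0 : C ≢ 0#) (B≢A : B ≢ A) (C≢B : C ≢ B) where

      vandermonde⇒A+C≡B : Vandermonde u₁ u₂ u₃ u₄ A B C → Point.d (walk A B C u₁ u₂ u₃ u₄) ≡ 0# → A + C ≡ B
      vandermonde⇒A+C≡B (B≢0 , A≢C , t , t≢0 , refl , refl , refl , refl) d≡0 =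
        x-y≡0⇒x≡y (x*y≡0∧x≢0⇒y≡0 (-x≡0⇒x≡0 (trans (sym (kernelWalk-d t A B C)) d≡0))
          (t≢0 ·≢0 t≢0 ·≢0 A≢0 ·≢0 B≢0 ·≢0 C≢0 ·≢0 x≢y⇒x-y≢0 (B≢A ∘ sym)
               ·≢0 x≢y⇒x-y≢0 (C≢B ∘ sym) ·≢0 x≢y⇒x-y≢0 (A≢C ∘ sym)))

      vandermonde⇒e≢0 : Vandermonde u₁ u₂ u₃ u₄ A B C → Point.e (walk A B C u₁ u₂ u₃ u₄) ≢ 0#
      vandermonde⇒e≢0 (B≢0 , A≢C , t , t≢0 , refl , refl , refl , refl) e≡0 =
        (t≢0 ·≢0 t≢0 ·≢0 A≢0 ·≢0 A≢0 ·≢0 B≢0 ·≢0 C≢0 ·≢0 C≢0 ·≢0 x≢y⇒x-y≢0 (B≢A ∘ sym)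
             ·≢0 x≢y⇒x-y≢0 (C≢B ∘ sym) ·≢0 x≢y⇒x-y≢0 (A≢C ∘ sym))
          (-x≡0⇒x≡0 (trans (sym (kernelWalk-e t A B C)) e≡0))

  module Octagon {k} (O : Cycle k 4) (3≤k : 3 ≤ k) where
    open Cycle O public

    U₁ U₂ U₃ U₄ A B C : Carrier
    U₁ = x 1F - x 0F
    U₂ = x 2F - x 1F
    U₃ = x 3F - x 2F
    U₄ = x 0F - x 3F
    A = y 1F - y 0F
    B = y 2F - y 0F
    C = y 3F - y 0F

    2≤k : 2 ≤ k
    2≤k = ℕₚ.≤-trans (s≤s (s≤s z≤n)) 3≤k

    U₁≢0 : U₁ ≢ 0#
    U₁≢0 = Δx≢0 2≤k 0F
    U₂≢0 : U₂ ≢ 0#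
    U₂≢0 = Δx≢0 2≤k 1F
    U₃≢0 : U₃ ≢ 0#
    U₃≢0 = Δx≢0 2≤k 2F
    A≢0 : A ≢ 0#
    A≢0 = x≢y⇒x-y≢0 (y-next≢y 0F)
    C≢0 : C ≢ 0#
    C≢0 = x≢y⇒x-y≢0 (y-next≢y 3F ∘ sym)
    B≢A : B ≢ A
    B≢A = y-next≢y 1F ∘ x-z≡y-z⇒x≡y
    C≢B : C ≢ B
    C≢B = y-next≢y 2F ∘ x-z≡y-z⇒x≡y

    shape : Symmetric U₁ U₂ U₃ U₄ A B C ⊎ Vandermonde U₁ U₂ U₃ U₄ A B C
    shape = symmetric-or-vandermonde U₁ U₂ U₃ U₄ A B C
      (solve 4 (λ x₁ x₂ x₃ x₄ → (x₂ :- x₁) :+ (x₃ :- x₂) :+ (x₄ :- x₃) :+ (x₁ :- x₄) := :0) refl (x 0F) (x 1F) (x 2F) (x 3F))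
      (octagon-closure-b _ _ _ _ _ _ _ _ _ _ _ _ (b-step 2≤k 0F) (b-step 2≤k 1F) (b-step 2≤k 2F) (b-step 2≤k 3F))
      (octagon-closure-c _ _ _ _ _ _ _ _ _ _ _ _ _ _ _ _ (b-step 2≤k 0F) (b-step 2≤k 1F) (b-step 2≤k 2F) (b-step 2≤k 3F)
        (c-step 3≤k 0F) (c-step 3≤k 1F) (c-step 3≤k 2F) (c-step 3≤k 3F))
      U₂≢0 U₃≢0 A≢0 C≢0 B≢A C≢B

    d-closes : 4 ≤ k → Point.d (walk A B C U₁ U₂ U₃ U₄) ≡ 0#
    d-closes 4≤k = octagon-closure-d _ _ _ _ _ _ _ _ _ _ _ _ _ _ _ _
      (b-step 2≤k 0F) (b-step 2≤k 1F) (b-step 2≤k 2F) (b-step 2≤k 3F)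
      (d-step 4≤k 0F) (d-step 4≤k 1F) (d-step 4≤k 2F) (d-step 4≤k 3F)

    e-closes : 5 ≤ k → Point.e (walk A B C U₁ U₂ U₃ U₄) ≡ 0#
    e-closes 5≤k = octagon-closure-e _ _ _ _ _ _ _ _ _ _ _ _ _ _ _ _ _ _ _ _ _ _ _ _
      (b-step 2≤k 0F) (b-step 2≤k 1F) (b-step 2≤k 2F) (b-step 2≤k 3F)
      (c-step 3≤k 0F) (c-step 3≤k 1F) (c-step 3≤k 2F)
      (d-step 4≤k 0F) (d-step 4≤k 1F) (d-step 4≤k 2F) (d-step 4≤k 3F)
      (e-step 5≤k 0F) (e-step 5≤k 1F) (e-step 5≤k 2F) (e-step 5≤k 3F)
      where
      4≤k : 4 ≤ k
      4≤k = ℕₚ.≤-trans (s≤s (s≤s (s≤s (s≤s z≤n)))) 5≤k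

  no-octagon : ∀ {k} → 5 ≤ k → ¬ Cycle k 4
  no-octagon 5≤k O =
    [ (λ s → symmetric⇒e≢0 s A≢0 U₁≢0 U₂≢0 (e-closes 5≤k))
    , (λ v → vandermonde⇒e≢0 A≢0 C≢0 B≢A C≢B v (e-closes 5≤k)) ]′ shape
    where open Octagon O (ℕₚ.≤-trans (s≤s (s≤s (s≤s z≤n))) 5≤k)

  i≢next[i] : (i : Fin 4) → i ≢ next i
  i≢next[i] 0F ()
  i≢next[i] 1F ()
  i≢next[i] 2F ()
  i≢next[i] 3F ()

  typed⇒cycle : ∀ {k u v} → TypedCycle k 3 u v → Cycle k 4
  typed⇒cycle T = record
    { l = l ; r = r ; l∈L = l∈L ; r∈R = r∈R ; adj-lr = adj-lr ; adj-rl = adj-rl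
    ; l-step = λ i → i≢next[i] i ∘ l-inj i (next i)
    ; r-step = λ i → i≢next[i] i ∘ r-inj i (next i)
    }
    where open TypedCycle T

  -- (u₁, v₁, …, u₄, v₄) is the type of an 8-cycle whose L-vertices have first coordinates
  -- with differences U₁, …, U₄ and whose R-vertices have first coordinates 0, A, B, C.
  Increments : (u₁ v₁ u₂ v₂ u₃ v₃ u₄ v₄ U₁ U₂ U₃ U₄ A B C : Carrier) → Set
  Increments u₁ v₁ u₂ v₂ u₃ v₃ u₄ v₄ U₁ U₂ U₃ U₄ A B C =
    u₁ ≡ U₁ × u₂ ≡ U₂ × u₃ ≡ U₃ × u₄ ≡ U₄ × v₁ ≡ A × v₂ ≡ B - A × v₃ ≡ C - B × v₄ ≡ - C

  module TypedOctagon {k u₁ v₁ u₂ v₂ u₃ v₃ u₄ v₄} (T : HasType8 k u₁ v₁ u₂ v₂ u₃ v₃ u₄ v₄) (3≤k : 3 ≤ k) where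
    open Octagon (typed⇒cycle T) 3≤k public
    open TypedCycle T using (u-def; v-def)

    v₂≡B-A : v₂ ≡ B - A
    v₂≡B-A = trans (v-def 1F) (solve 3 (λ y₀ y₁ y₂ → y₂ :- y₁ := (y₂ :- y₀) :- (y₁ :- y₀)) refl (y 0F) (y 1F) (y 2F))

    increments : Increments u₁ v₁ u₂ v₂ u₃ v₃ u₄ v₄ U₁ U₂ U₃ U₄ A B C
    increments = u-def 0F , u-def 1F , u-def 2F , u-def 3F , v-def 0F , v₂≡B-A ,
      trans (v-def 2F) (solve 3 (λ y₀ y₂ y₃ → y₃ :- y₂ := (y₃ :- y₀) :- (y₂ :- y₀)) refl (y 0F) (y 2F) (y 3F)) ,
      trans (v-def 3F) (solve 2 (λ y₀ y₃ → y₀ :- y₃ := :- (y₃ :- y₀)) refl (y 0F) (y 3F))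

    v₁+v₂≡B : v₁ + v₂ ≡ B
    v₁+v₂≡B = trans (cong₂ _+_ (v-def 0F) v₂≡B-A) (sym (b≡a+[b-a] A B))

    symmetric : v₁ + v₂ ≡ 0# → Symmetric U₁ U₂ U₃ U₄ A B C
    symmetric v₁+v₂≡0 = [ id , (λ v → ⊥-elim (proj₁ v (trans (sym v₁+v₂≡B) v₁+v₂≡0))) ]′ shape

    vandermonde : v₁ + v₂ ≢ 0# → Vandermonde U₁ U₂ U₃ U₄ A B C
    vandermonde v₁+v₂≢0 = [ (λ s → ⊥-elim (v₁+v₂≢0 (trans v₁+v₂≡B (proj₁ s)))) , id ]′ shape

  module _ {u₁ v₁ u₂ v₂ u₃ v₃ u₄ v₄ U₁ U₂ U₃ U₄ A B C : Carrier} where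

    symmetric⇒SpecialForm : Increments u₁ v₁ u₂ v₂ u₃ v₃ u₄ v₄ U₁ U₂ U₃ U₄ A B C → Symmetric U₁ U₂ U₃ U₄ A B C →
      u₁ ≢ 0# → v₁ ≢ 0# → u₂ ≢ 0# → SpecialForm u₁ v₁ u₂ v₂ u₃ v₃ u₄ v₄
    symmetric⇒SpecialForm (refl , refl , refl , refl , refl , refl , refl , refl) (refl , refl , refl , refl) u₁≢0 v₁≢0 u₂≢0 =
      U₁ , A , U₂ , u₁≢0 , v₁≢0 , u₂≢0 , refl , refl , refl , solve 1 (λ A → :0 :- A := :- A) refl A ,
      refl , solve 1 (λ A → A :- :0 := A) refl A , refl , refl

    vandermonde⇒EqsC : Increments u₁ v₁ u₂ v₂ u₃ v₃ u₄ v₄ U₁ U₂ U₃ U₄ A B C → Vandermonde U₁ U₂ U₃ U₄ A B C →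
      A ≢ 0# → C ≢ 0# → B ≢ A → C ≢ B →
      Σ Carrier λ t → GoodTABC t A B C × EqsC t A B C u₁ v₁ u₂ v₂ u₃ v₃ u₄ v₄
    vandermonde⇒EqsC (refl , refl , refl , refl , refl , refl , refl , refl) (B≢0 , A≢C , t , t≢0 , refl , refl , refl , refl)
      A≢0 C≢0 B≢A C≢B =
      t , (t≢0 , A≢0 , B≢0 , C≢0 , B≢A ∘ sym , C≢B ∘ sym , A≢C) , (refl , refl , refl , refl , refl , refl , refl , refl)

  lVertex : Point → V 4
  lVertex (point x b c d _) = x ∷ b ∷ b ∷ c ∷ d ∷ []

  rVertex : Carrier → Point → V 4
  rVertex y (point x b c d _) = y ∷ 0# ∷ (y * x - b) ∷ (y * b - c) ∷ (x * (y * x - b) - d) ∷ []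

  Adj₄-intro : ∀ (l r : V 4) → at l 2 + at r 2 ≡ at r 0 * at l 0 → at l 3 + at r 3 ≡ at r 0 * at l 1 →
               at l 4 + at r 4 ≡ at l 0 * at r 2 → Adj 4 l r
  Adj₄-intro l r e₂ e₃ e₄ 0 () _
  Adj₄-intro l r e₂ e₃ e₄ 1 (s≤s ()) _
  Adj₄-intro l r e₂ e₃ e₄ 2 _ _ = e₂
  Adj₄-intro l r e₂ e₃ e₄ 3 _ _ = e₃
  Adj₄-intro l r e₂ e₃ e₄ 4 _ _ = e₄
  Adj₄-intro l r e₂ e₃ e₄ (suc (suc (suc (suc (suc _))))) _ (s≤s (s≤s (s≤s (s≤s ()))))

  lVertex∼rVertex : ∀ y P → Adj 4 (lVertex P) (rVertex y P)
  lVertex∼rVertex y P@(point x b c d _) = Adj₄-intro (lVertex P) (rVertex y P) (cancel b (y * x)) (cancel c (y * b)) (cancel d (x * (y * x - b)))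
    where
    cancel : ∀ a p → a + (p - a) ≡ p
    cancel = solve 2 (λ a p → a :+ (p :- a) := p) refl

  step∼rVertex : ∀ y u P → Adj 4 (lVertex (step y u P)) (rVertex y P)
  step∼rVertex y u P@(point x b c d _) = Adj₄-intro (lVertex (step y u P)) (rVertex y P)
    (solve 4 (λ x b y u → (b :+ y :* u) :+ (y :* x :- b) := y :* (x :+ u)) refl x b y u)
    (solve 4 (λ b c y u → (c :+ y :* (y :* u)) :+ (y :* b :- c) := y :* (b :+ y :* u)) refl b c y u)
    (solve 5 (λ x b d y u → (d :+ (y :* x :- b) :* u) :+ (x :* (y :* x :- b) :- d) := (x :+ u) :* (y :* x :- b)) refl x b d y u)

  truncate : V 4 → V 3
  truncate (a ∷ b ∷ c ∷ d ∷ _ ∷ []) = a ∷ b ∷ c ∷ d ∷ []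

  -- How the vertices of Λ_{4,q} built below become vertices of Λ_{k,q}.
  record Truncation (k : ℕ) : Set where
    field
      cut      : V 4 → V k
      cut-adj  : ∀ l r → Adj 4 l r → Adj k (cut l) (cut r)
      cut-at   : ∀ v i → i ≤ 2 → at (cut v) i ≡ at v i
      cut-zero : cut (zeroV 4) ≡ zeroV k

    cut-≢ : ∀ v w i → i ≤ 2 → at v i ≢ at w i → cut v ≢ cut w
    cut-≢ v w i i≤2 vᵢ≢wᵢ v≡w = vᵢ≢wᵢ (trans (sym (cut-at v i i≤2)) (trans (cong (λ z → at z i) v≡w) (cut-at w i i≤2)))

  keep-all : Truncation 4
  keep-all = record { cut = id ; cut-adj = λ _ _ adj → adj ; cut-at = λ _ _ _ → refl ; cut-zero = refl }

  drop-last : Truncation 3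
  drop-last = record { cut = truncate ; cut-adj = truncate-adj ; cut-at = truncate-at ; cut-zero = refl }
    where
    truncate-adj : ∀ l r → Adj 4 l r → Adj 3 (truncate l) (truncate r)
    truncate-adj (_ ∷ _ ∷ _ ∷ _ ∷ _ ∷ []) (_ ∷ _ ∷ _ ∷ _ ∷ _ ∷ []) adj 0 () _
    truncate-adj (_ ∷ _ ∷ _ ∷ _ ∷ _ ∷ []) (_ ∷ _ ∷ _ ∷ _ ∷ _ ∷ []) adj 1 (s≤s ()) _
    truncate-adj (_ ∷ _ ∷ _ ∷ _ ∷ _ ∷ []) (_ ∷ _ ∷ _ ∷ _ ∷ _ ∷ []) adj 2 2≤i _ = adj 2 2≤i (s≤s (s≤s z≤n))
    truncate-adj (_ ∷ _ ∷ _ ∷ _ ∷ _ ∷ []) (_ ∷ _ ∷ _ ∷ _ ∷ _ ∷ []) adj 3 2≤i _ = adj 3 2≤i (s≤s (s≤s (s≤s z≤n)))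
    truncate-adj (_ ∷ _ ∷ _ ∷ _ ∷ _ ∷ []) (_ ∷ _ ∷ _ ∷ _ ∷ _ ∷ []) adj (suc (suc (suc (suc _)))) _ (s≤s (s≤s (s≤s ())))
    truncate-at : ∀ v i → i ≤ 2 → at (truncate v) i ≡ at v i
    truncate-at (_ ∷ _ ∷ _ ∷ _ ∷ _ ∷ []) 0 _ = refl
    truncate-at (_ ∷ _ ∷ _ ∷ _ ∷ _ ∷ []) 1 _ = refl
    truncate-at (_ ∷ _ ∷ _ ∷ _ ∷ _ ∷ []) 2 _ = refl
    truncate-at (_ ∷ _ ∷ _ ∷ _ ∷ _ ∷ []) (suc (suc (suc _))) (s≤s (s≤s ()))

  injective₄ : ∀ {X : Set} (f : Fin 4 → X) → (∀ i → f i ≢ f (next i)) → f 0F ≢ f 2F → f 1F ≢ f 3F →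
               ∀ i j → f i ≡ f j → i ≡ j
  injective₄ f step f₀≢f₂ f₁≢f₃ = go
    where
    go : ∀ i j → f i ≡ f j → i ≡ j
    go 0F 0F _ = refl
    go 1F 1F _ = refl
    go 2F 2F _ = refl
    go 3F 3F _ = refl
    go 0F 1F e = ⊥-elim (step 0F e)
    go 1F 2F e = ⊥-elim (step 1F e)
    go 2F 3F e = ⊥-elim (step 2F e)
    go 3F 0F e = ⊥-elim (step 3F e)
    go 1F 0F e = ⊥-elim (step 0F (sym e))
    go 2F 1F e = ⊥-elim (step 1F (sym e))
    go 3F 2F e = ⊥-elim (step 2F (sym e))
    go 0F 3F e = ⊥-elim (step 3F (sym e))
    go 0F 2F e = ⊥-elim (f₀≢f₂ e)
    go 2F 0F e = ⊥-elim (f₀≢f₂ (sym e))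
    go 1F 3F e = ⊥-elim (f₁≢f₃ e)
    go 3F 1F e = ⊥-elim (f₁≢f₃ (sym e))

  rVertex-origin : rVertex 0# origin ≡ zeroV 4
  rVertex-origin = cong₂ (λ p s → 0# ∷ 0# ∷ p ∷ p ∷ s ∷ [])
    (solve 0 (:0 :* :0 :- :0 := :0) refl) (solve 0 (:0 :* (:0 :* :0 :- :0) :- :0 := :0) refl)

  u≡[x+u]-x : ∀ x u → u ≡ (x + u) - x
  u≡[x+u]-x = solve 2 (λ x u → u := (x :+ u) :- x) refl

  -- The walk from the origin through R-vertices with first coordinates 0, A, B, C and with
  -- L-increments u₁, …, u₄; once it closes up, it is an 8-cycle of that type.
  module Build {k} (T : Truncation k) (A B C u₁ u₂ u₃ u₄ : Carrier) where
    open Truncation T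

    P : Fin 4 → Point
    P 0F = origin
    P 1F = walk₁ u₁
    P 2F = walk₂ A u₁ u₂
    P 3F = walk₃ A B u₁ u₂ u₃

    y : Fin 4 → Carrier
    y 0F = 0#
    y 1F = A
    y 2F = B
    y 3F = C

    u : Vec Carrier 4
    u = u₁ ∷ u₂ ∷ u₃ ∷ u₄ ∷ []

    lv rv : Fin 4 → V k
    lv i = cut (lVertex (P i))
    rv i = cut (rVertex (y i) (P i))

    module _ {v : Vec Carrier 4}
      (closes : cut (lVertex (walk A B C u₁ u₂ u₃ u₄)) ≡ cut (lVertex origin))
      (v-def : ∀ i → lookup v i ≡ y (next i) - y i)
      (u≢0 : ∀ i → lookup u i ≢ 0#) (v≢0 : ∀ i → lookup v i ≢ 0#)
      (l₀≢l₂ : lv 0F ≢ lv 2F) (l₁≢l₃ : lv 1F ≢ lv 3F) (r₀≢r₂ : rv 0F ≢ rv 2F) (r₁≢r₃ : rv 1F ≢ rv 3F) where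

      l-next : ∀ i → Adj k (lv (next i)) (rv i)
      l-next 0F = cut-adj _ _ (step∼rVertex 0# u₁ (P 0F))
      l-next 1F = cut-adj _ _ (step∼rVertex A u₂ (P 1F))
      l-next 2F = cut-adj _ _ (step∼rVertex B u₃ (P 2F))
      l-next 3F = subst (λ z → Adj k z (rv 3F)) closes (cut-adj _ _ (step∼rVertex C u₄ (P 3F)))

      x-closes : Point.x (P 3F) + u₄ ≡ 0#
      x-closes = trans (sym (cut-at _ 0 z≤n)) (trans (cong (λ z → at z 0) closes) (cut-at _ 0 z≤n))

      Δx≡u : ∀ i → lookup u i ≡ Point.x (P (next i)) - Point.x (P i)
      Δx≡u 0F = u≡[x+u]-x 0# u₁
      Δx≡u 1F = u≡[x+u]-x _ u₂
      Δx≡u 2F = u≡[x+u]-x _ u₃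
      Δx≡u 3F = trans (x+y≡0⇒y≡-x x-closes) (solve 1 (λ x → :- x := :0 :- x) refl (Point.x (P 3F)))

      u-def : ∀ i → lookup u i ≡ at (lv (next i)) 0 - at (lv i) 0
      u-def i = trans (Δx≡u i) (sym (cong₂ _-_ (cut-at _ 0 z≤n) (cut-at _ 0 z≤n)))

      v-def′ : ∀ i → lookup v i ≡ at (rv (next i)) 0 - at (rv i) 0
      v-def′ i = trans (v-def i) (sym (cong₂ _-_ (cut-at _ 0 z≤n) (cut-at _ 0 z≤n)))

      typedCycle : TypedCycle k 3 u v
      typedCycle = record
        { l = lv ; r = rv
        ; l∈L = λ i → trans (cut-at _ 1 (s≤s z≤n)) (sym (cut-at _ 2 ℕₚ.≤-refl))
        ; r∈R = λ i → cut-at _ 1 (s≤s z≤n)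
        ; l-inj = injective₄ lv (λ i → u≢0 i ∘ λ e → trans (u-def i) (x≈y⇒x∙y⁻¹≈ε (cong (λ z → at z 0) (sym e)))) l₀≢l₂ l₁≢l₃
        ; r-inj = injective₄ rv (λ i → v≢0 i ∘ λ e → trans (v-def′ i) (x≈y⇒x∙y⁻¹≈ε (cong (λ z → at z 0) (sym e)))) r₀≢r₂ r₁≢r₃
        ; adj-lr = λ i → cut-adj _ _ (lVertex∼rVertex (y i) (P i))
        ; adj-rl = l-next
        ; l₀ = cut-zero
        ; r₀ = trans (cong cut rVertex-origin) cut-zero
        ; u-def = u-def
        ; v-def = v-def′
        }

  closes₃⇒ : ∀ P → Closes₃ P → truncate (lVertex P) ≡ truncate (lVertex origin)
  closes₃⇒ P (x≡0 , b≡0 , c≡0) = cong₃ (λ x b c → x ∷ b ∷ b ∷ c ∷ []) x≡0 b≡0 c≡0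

  closes₄⇒ : ∀ P → Closes₃ P → Point.d P ≡ 0# → lVertex P ≡ lVertex origin
  closes₄⇒ P (x≡0 , b≡0 , c≡0) d≡0 =
    cong₂ (λ x (bcd : Carrier × Carrier × Carrier) → x ∷ proj₁ bcd ∷ proj₁ bcd ∷ proj₁ (proj₂ bcd) ∷ proj₂ (proj₂ bcd) ∷ [])
      x≡0 (cong₃ (λ b c d → b , c , d) b≡0 c≡0 d≡0)

  x≡x-0 : ∀ x → x ≡ x - 0#
  x≡x-0 = solve 1 (λ x → x := x :- :0) refl

  -x≡0-x : ∀ x → - x ≡ 0# - x
  -x≡0-x = solve 1 (λ x → :- x := :0 :- x) refl

  -- Consecutive vertices differ in coordinate 0; opposite ones are told apart by coordinate 2
  -- (or, for R-vertices of the kernel cycles, again by coordinate 0).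
  symmetricCycle : ∀ {k} (T : Truncation k) r s t → r ≢ 0# → s ≢ 0# → t ≢ 0# →
    Truncation.cut T (lVertex (symmetricWalk s r t)) ≡ Truncation.cut T (lVertex origin) →
    HasType8 k r s t (- s) (- r) s (- t) (- s)
  symmetricCycle T r s t r≢0 s≢0 t≢0 closes = typedCycle closes v-def u≢0 v≢0
    (cut-≢ _ _ 2 ℕₚ.≤-refl (differ-by Δb₀₂ (s≢0 ·≢0 t≢0)))
    (cut-≢ _ _ 2 ℕₚ.≤-refl (differ-by Δb₁₃ (s≢0 ·≢0 t≢0)))
    (cut-≢ _ _ 2 ℕₚ.≤-refl (differ-by Δr₀₂ (-x≢0 (s≢0 ·≢0 t≢0))))
    (cut-≢ _ _ 2 ℕₚ.≤-refl (differ-by Δr₁₃ (-x≢0 (s≢0 ·≢0 r≢0))))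
    where
    open Build T s 0# s r t (- r) (- t)
    open Truncation T
    v-def : ∀ i → lookup (s ∷ - s ∷ s ∷ - s ∷ []) i ≡ y (next i) - y i
    v-def 0F = x≡x-0 s
    v-def 1F = -x≡0-x s
    v-def 2F = x≡x-0 s
    v-def 3F = -x≡0-x s
    u≢0 : ∀ i → lookup u i ≢ 0#
    u≢0 0F = r≢0
    u≢0 1F = t≢0
    u≢0 2F = -x≢0 r≢0
    u≢0 3F = -x≢0 t≢0
    v≢0 : ∀ i → lookup (s ∷ - s ∷ s ∷ - s ∷ []) i ≢ 0#
    v≢0 0F = s≢0
    v≢0 1F = -x≢0 s≢0
    v≢0 2F = s≢0
    v≢0 3F = -x≢0 s≢0
    Δb₀₂ : Point.b (walk₂ s r t) - 0# ≡ s * t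
    Δb₀₂ = solve 3 (λ r s t → Syntax.Point.b (Syntax.walk₂ s r t) :- :0 := s :* t) refl r s t
    Δb₁₃ : Point.b (walk₃ s 0# r t (- r)) - Point.b (walk₁ r) ≡ s * t
    Δb₁₃ = solve 3 (λ r s t → Syntax.Point.b (Syntax.walk₃ s :0 r t (:- r)) :- Syntax.Point.b (Syntax.walk₁ r) := s :* t)
      refl r s t
    Δr₀₂ : (0# * Point.x (walk₂ s r t) - Point.b (walk₂ s r t)) - (0# * 0# - 0#) ≡ - (s * t)
    Δr₀₂ = solve 3 (λ r s t → (:0 :* Syntax.Point.x (Syntax.walk₂ s r t) :- Syntax.Point.b (Syntax.walk₂ s r t))
                               :- (:0 :* :0 :- :0) := :- (s :* t)) refl r s t
    Δr₁₃ : (s * Point.x (walk₃ s 0# r t (- r)) - Point.b (walk₃ s 0# r t (- r)))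
           - (s * Point.x (walk₁ r) - Point.b (walk₁ r)) ≡ - (s * r)
    Δr₁₃ = solve 3 (λ r s t → (s :* Syntax.Point.x (Syntax.walk₃ s :0 r t (:- r)) :- Syntax.Point.b (Syntax.walk₃ s :0 r t (:- r)))
                               :- (s :* Syntax.Point.x (Syntax.walk₁ r) :- Syntax.Point.b (Syntax.walk₁ r)) := :- (s :* r))
      refl r s t

  kernelCycle : ∀ {k} (T : Truncation k) t a b c → GoodTABC t a b c →
    Truncation.cut T (lVertex (kernelWalk t a b c)) ≡ Truncation.cut T (lVertex origin) →
    HasType8 k (kernel t a b c 0F) a (kernel t a b c 1F) (b - a) (kernel t a b c 2F) (c - b) (kernel t a b c 3F) (- c)
  kernelCycle T t a b c (t≢0 , a≢0 , b≢0 , c≢0 , a≢b , b≢c , a≢c) closes = typedCycle closes v-def u≢0 v≢0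
    (cut-≢ _ _ 2 ℕₚ.≤-refl (differ-by Δb₀₂ (t≢0 ·≢0 a≢0 ·≢0 b≢0 ·≢0 c≢0 ·≢0 x≢y⇒x-y≢0 (b≢c ∘ sym))))
    (cut-≢ _ _ 2 ℕₚ.≤-refl (differ-by Δb₁₃ (t≢0 ·≢0 a≢0 ·≢0 b≢0 ·≢0 c≢0 ·≢0 x≢y⇒x-y≢0 a≢b)))
    (cut-≢ _ _ 0 z≤n (b≢0 ∘ sym))
    (cut-≢ _ _ 0 z≤n a≢c)
    where
    open Build T a b c (kernel t a b c 0F) (kernel t a b c 1F) (kernel t a b c 2F) (kernel t a b c 3F)
    open Truncation T
    v-def : ∀ i → lookup (a ∷ b - a ∷ c - b ∷ - c ∷ []) i ≡ y (next i) - y i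
    v-def 0F = x≡x-0 a
    v-def 1F = refl
    v-def 2F = refl
    v-def 3F = -x≡0-x c
    u≢0 : ∀ i → lookup u i ≢ 0#
    u≢0 0F = t≢0 ·≢0 x≢y⇒x-y≢0 (b≢c ∘ sym) ·≢0 x≢y⇒x-y≢0 a≢c ·≢0 x≢y⇒x-y≢0 (a≢b ∘ sym)
    u≢0 1F = t≢0 ·≢0 b≢0 ·≢0 c≢0 ·≢0 x≢y⇒x-y≢0 (b≢c ∘ sym)
    u≢0 2F = t≢0 ·≢0 a≢0 ·≢0 c≢0 ·≢0 x≢y⇒x-y≢0 a≢c
    u≢0 3F = t≢0 ·≢0 a≢0 ·≢0 b≢0 ·≢0 x≢y⇒x-y≢0 (a≢b ∘ sym)
    v≢0 : ∀ i → lookup (a ∷ b - a ∷ c - b ∷ - c ∷ []) i ≢ 0#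
    v≢0 0F = a≢0
    v≢0 1F = x≢y⇒x-y≢0 (a≢b ∘ sym)
    v≢0 2F = x≢y⇒x-y≢0 (b≢c ∘ sym)
    v≢0 3F = -x≢0 c≢0
    Δb₀₂ : Point.b (walk₂ a (kernel t a b c 0F) (kernel t a b c 1F)) - 0# ≡ t * a * b * c * (c - b)
    Δb₀₂ = solve 4 (λ t a b c → Syntax.Point.b (Syntax.walk₂ a (Syntax.kernel t a b c 0F) (Syntax.kernel t a b c 1F)) :- :0
                                := t :* a :* b :* c :* (c :- b)) refl t a b c
    Δb₁₃ : Point.b (walk₃ a b (kernel t a b c 0F) (kernel t a b c 1F) (kernel t a b c 2F))
           - Point.b (walk₁ (kernel t a b c 0F)) ≡ t * a * b * c * (a - b)
    Δb₁₃ = solve 4 (λ t a b c →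
      Syntax.Point.b (Syntax.walk₃ a b (Syntax.kernel t a b c 0F) (Syntax.kernel t a b c 1F) (Syntax.kernel t a b c 2F))
        :- Syntax.Point.b (Syntax.walk₁ (Syntax.kernel t a b c 0F)) := t :* a :* b :* c :* (a :- b)) refl t a b c

  symmetricCycle₃ : ∀ r s t → r ≢ 0# → s ≢ 0# → t ≢ 0# → HasType8 3 r s t (- s) (- r) s (- t) (- s)
  symmetricCycle₃ r s t r≢0 s≢0 t≢0 =
    symmetricCycle drop-last r s t r≢0 s≢0 t≢0 (closes₃⇒ (symmetricWalk s r t) (symmetricWalk-closes₃ s r t))

  symmetricCycle₄ : ∀ r s t → r ≢ 0# → s ≢ 0# → t ≢ 0# → Char2 → HasType8 4 r s t (- s) (- r) s (- t) (- s)
  symmetricCycle₄ r s t r≢0 s≢0 t≢0 1+1≡0 =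
    symmetricCycle keep-all r s t r≢0 s≢0 t≢0
      (closes₄⇒ (symmetricWalk s r t) (symmetricWalk-closes₃ s r t) (symmetricWalk-d≡0 1+1≡0 s r t))

  kernelCycle₃ : ∀ t a b c → GoodTABC t a b c →
    HasType8 3 (kernel t a b c 0F) a (kernel t a b c 1F) (b - a) (kernel t a b c 2F) (c - b) (kernel t a b c 3F) (- c)
  kernelCycle₃ t a b c good = kernelCycle drop-last t a b c good (closes₃⇒ (kernelWalk t a b c) (kernelWalk-closes₃ t a b c))

  kernelCycle₄ : ∀ t a b c → GoodTABC t a b c → a + c ≡ b →
    HasType8 4 (kernel t a b c 0F) a (kernel t a b c 1F) (b - a) (kernel t a b c 2F) (c - b) (kernel t a b c 3F) (- c)
  kernelCycle₄ t a b c good a+c≡b = kernelCycle keep-all t a b c good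
    (closes₄⇒ (kernelWalk t a b c) (kernelWalk-closes₃ t a b c) (kernelWalk-d≡0 t a b c a+c≡b))

  side : ∀ {k} → Vertex k → Bool
  side (inj₁ _) = true
  side (inj₂ _) = false

  edge-flips-side : ∀ {k} (w w' : Vertex k) → Edge k w w' → side w' ≡ not (side w)
  edge-flips-side (inj₁ _) (inj₂ _) _ = refl
  edge-flips-side (inj₂ _) (inj₁ _) _ = refl

  odd-steps : ∀ {n} → ℕ → Fin n → Fin n
  odd-steps zero    i = next i
  odd-steps (suc j) i = odd-steps j (next (next i))

  no-odd-cycle : ∀ {k m} j (i : Fin m) → odd-steps j i ≡ i → ¬ HasCycle k m
  no-odd-cycle {k} j i returns (_ , f , _ , _ , f-edge) = not-¬ refl (trans (cong (side ∘ f) (sym returns)) (flips j i))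
    where
    flip : ∀ i → side (f (next i)) ≡ not (side (f i))
    flip i = edge-flips-side (f i) (f (next i)) (f-edge i)
    flips : ∀ j i → side (f (odd-steps j i)) ≡ not (side (f i))
    flips zero    i = flip i
    flips (suc j) i = trans (flips j (next (next i)))
      (cong not (trans (flip (next i)) (trans (cong not (flip i)) (not-involutive _))))

  apart : ∀ {k m} (c : HasCycle k m) i j → i ≢ j → proj₁ (proj₂ c) i ≢ proj₁ (proj₂ c) j
  apart (_ , _ , _ , f-inj , _) i j i≢j = i≢j ∘ f-inj i j

  module _ {k : ℕ} where

    read₂ : ∀ l₀ (w₁ w₂ w₃ : Vertex k) → InL l₀ → IsVertex w₁ → IsVertex w₂ → IsVertex w₃ →
      Edge k (inj₁ l₀) w₁ → Edge k w₁ w₂ → Edge k w₂ w₃ → Edge k w₃ (inj₁ l₀) →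
      inj₁ l₀ ≢ w₂ → w₁ ≢ w₃ → Cycle k 2
    read₂ l₀ (inj₂ r₀) (inj₁ l₁) (inj₂ r₁) l₀∈ r₀∈ l₁∈ r₁∈ e₀ e₁ e₂ e₃ d₀ d₁ = record
      { l = λ { 0F → l₀ ; 1F → l₁ } ; r = λ { 0F → r₀ ; 1F → r₁ }
      ; l∈L = λ { 0F → l₀∈ ; 1F → l₁∈ } ; r∈R = λ { 0F → r₀∈ ; 1F → r₁∈ }
      ; adj-lr = λ { 0F → e₀ ; 1F → e₂ } ; adj-rl = λ { 0F → e₁ ; 1F → e₃ }
      ; l-step = λ { 0F → d₀ ∘ cong inj₁ ; 1F → d₀ ∘ cong inj₁ ∘ sym }
      ; r-step = λ { 0F → d₁ ∘ cong inj₂ ; 1F → d₁ ∘ cong inj₂ ∘ sym }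
      }

    read₃ : ∀ l₀ (w₁ w₂ w₃ w₄ w₅ : Vertex k) → InL l₀ →
      IsVertex w₁ → IsVertex w₂ → IsVertex w₃ → IsVertex w₄ → IsVertex w₅ →
      Edge k (inj₁ l₀) w₁ → Edge k w₁ w₂ → Edge k w₂ w₃ → Edge k w₃ w₄ → Edge k w₄ w₅ → Edge k w₅ (inj₁ l₀) →
      inj₁ l₀ ≢ w₂ → w₁ ≢ w₃ → w₂ ≢ w₄ → w₃ ≢ w₅ → w₄ ≢ inj₁ l₀ → w₅ ≢ w₁ → Cycle k 3
    read₃ l₀ (inj₂ r₀) (inj₁ l₁) (inj₂ r₁) (inj₁ l₂) (inj₂ r₂) l₀∈ r₀∈ l₁∈ r₁∈ l₂∈ r₂∈
          e₀ e₁ e₂ e₃ e₄ e₅ d₀ d₁ d₂ d₃ d₄ d₅ = record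
      { l = λ { 0F → l₀ ; 1F → l₁ ; 2F → l₂ } ; r = λ { 0F → r₀ ; 1F → r₁ ; 2F → r₂ }
      ; l∈L = λ { 0F → l₀∈ ; 1F → l₁∈ ; 2F → l₂∈ } ; r∈R = λ { 0F → r₀∈ ; 1F → r₁∈ ; 2F → r₂∈ }
      ; adj-lr = λ { 0F → e₀ ; 1F → e₂ ; 2F → e₄ } ; adj-rl = λ { 0F → e₁ ; 1F → e₃ ; 2F → e₅ }
      ; l-step = λ { 0F → d₀ ∘ cong inj₁ ; 1F → d₂ ∘ cong inj₁ ; 2F → d₄ ∘ cong inj₁ }
      ; r-step = λ { 0F → d₁ ∘ cong inj₂ ; 1F → d₃ ∘ cong inj₂ ; 2F → d₅ ∘ cong inj₂ }
      }

    read₄ : ∀ l₀ (w₁ w₂ w₃ w₄ w₅ w₆ w₇ : Vertex k) → InL l₀ →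
      IsVertex w₁ → IsVertex w₂ → IsVertex w₃ → IsVertex w₄ → IsVertex w₅ → IsVertex w₆ → IsVertex w₇ →
      Edge k (inj₁ l₀) w₁ → Edge k w₁ w₂ → Edge k w₂ w₃ → Edge k w₃ w₄ →
      Edge k w₄ w₅ → Edge k w₅ w₆ → Edge k w₆ w₇ → Edge k w₇ (inj₁ l₀) →
      inj₁ l₀ ≢ w₂ → w₁ ≢ w₃ → w₂ ≢ w₄ → w₃ ≢ w₅ → w₄ ≢ w₆ → w₅ ≢ w₇ → w₆ ≢ inj₁ l₀ → w₇ ≢ w₁ → Cycle k 4
    read₄ l₀ (inj₂ r₀) (inj₁ l₁) (inj₂ r₁) (inj₁ l₂) (inj₂ r₂) (inj₁ l₃) (inj₂ r₃) l₀∈ r₀∈ l₁∈ r₁∈ l₂∈ r₂∈ l₃∈ r₃∈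
          e₀ e₁ e₂ e₃ e₄ e₅ e₆ e₇ d₀ d₁ d₂ d₃ d₄ d₅ d₆ d₇ = record
      { l = λ { 0F → l₀ ; 1F → l₁ ; 2F → l₂ ; 3F → l₃ } ; r = λ { 0F → r₀ ; 1F → r₁ ; 2F → r₂ ; 3F → r₃ }
      ; l∈L = λ { 0F → l₀∈ ; 1F → l₁∈ ; 2F → l₂∈ ; 3F → l₃∈ }
      ; r∈R = λ { 0F → r₀∈ ; 1F → r₁∈ ; 2F → r₂∈ ; 3F → r₃∈ }
      ; adj-lr = λ { 0F → e₀ ; 1F → e₂ ; 2F → e₄ ; 3F → e₆ }
      ; adj-rl = λ { 0F → e₁ ; 1F → e₃ ; 2F → e₅ ; 3F → e₇ }
      ; l-step = λ { 0F → d₀ ∘ cong inj₁ ; 1F → d₂ ∘ cong inj₁ ; 2F → d₄ ∘ cong inj₁ ; 3F → d₆ ∘ cong inj₁ }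
      ; r-step = λ { 0F → d₁ ∘ cong inj₂ ; 1F → d₃ ∘ cong inj₂ ; 2F → d₅ ∘ cong inj₂ ; 3F → d₇ ∘ cong inj₂ }
      }

  -- A cycle starting on the R side is read from its second vertex.
  quadrilateral : ∀ {k} → HasCycle k 4 → Cycle k 2
  quadrilateral {k} c@(_ , f , f∈ , _ , f-edge) =
    from (f 0F) (f 1F) (f 2F) (f 3F) (f∈ 0F) (f∈ 1F) (f∈ 2F) (f∈ 3F)
      (f-edge 0F) (f-edge 1F) (f-edge 2F) (f-edge 3F) (apart c 0F 2F (λ ())) (apart c 1F 3F (λ ()))
      (apart c 2F 0F (λ ())) (apart c 3F 1F (λ ()))
    where
    from : ∀ (w₀ w₁ w₂ w₃ : Vertex k) → IsVertex w₀ → IsVertex w₁ → IsVertex w₂ → IsVertex w₃ →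
      Edge k w₀ w₁ → Edge k w₁ w₂ → Edge k w₂ w₃ → Edge k w₃ w₀ → w₀ ≢ w₂ → w₁ ≢ w₃ → w₂ ≢ w₀ → w₃ ≢ w₁ → Cycle k 2
    from (inj₁ l₀) w₁ w₂ w₃ v₀ v₁ v₂ v₃ e₀ e₁ e₂ e₃ d₀ d₁ _ _ = read₂ l₀ w₁ w₂ w₃ v₀ v₁ v₂ v₃ e₀ e₁ e₂ e₃ d₀ d₁
    from (inj₂ r) (inj₁ l₀) w₂ w₃ v₀ v₁ v₂ v₃ e₀ e₁ e₂ e₃ _ d₁ d₂ _ = read₂ l₀ w₂ w₃ (inj₂ r) v₁ v₂ v₃ v₀ e₁ e₂ e₃ e₀ d₁ d₂

  hexagon : ∀ {k} → HasCycle k 6 → Cycle k 3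
  hexagon {k} c@(_ , f , f∈ , _ , f-edge) =
    from (f 0F) (f 1F) (f 2F) (f 3F) (f 4F) (f 5F) (f∈ 0F) (f∈ 1F) (f∈ 2F) (f∈ 3F) (f∈ 4F) (f∈ 5F)
      (f-edge 0F) (f-edge 1F) (f-edge 2F) (f-edge 3F) (f-edge 4F) (f-edge 5F)
      (apart c 0F 2F (λ ())) (apart c 1F 3F (λ ())) (apart c 2F 4F (λ ()))
      (apart c 3F 5F (λ ())) (apart c 4F 0F (λ ())) (apart c 5F 1F (λ ()))
    where
    from : ∀ (w₀ w₁ w₂ w₃ w₄ w₅ : Vertex k) →
      IsVertex w₀ → IsVertex w₁ → IsVertex w₂ → IsVertex w₃ → IsVertex w₄ → IsVertex w₅ →
      Edge k w₀ w₁ → Edge k w₁ w₂ → Edge k w₂ w₃ → Edge k w₃ w₄ → Edge k w₄ w₅ → Edge k w₅ w₀ →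
      w₀ ≢ w₂ → w₁ ≢ w₃ → w₂ ≢ w₄ → w₃ ≢ w₅ → w₄ ≢ w₀ → w₅ ≢ w₁ → Cycle k 3
    from (inj₁ l₀) w₁ w₂ w₃ w₄ w₅ v₀ v₁ v₂ v₃ v₄ v₅ e₀ e₁ e₂ e₃ e₄ e₅ d₀ d₁ d₂ d₃ d₄ d₅ =
      read₃ l₀ w₁ w₂ w₃ w₄ w₅ v₀ v₁ v₂ v₃ v₄ v₅ e₀ e₁ e₂ e₃ e₄ e₅ d₀ d₁ d₂ d₃ d₄ d₅
    from (inj₂ r) (inj₁ l₀) w₂ w₃ w₄ w₅ v₀ v₁ v₂ v₃ v₄ v₅ e₀ e₁ e₂ e₃ e₄ e₅ d₀ d₁ d₂ d₃ d₄ d₅ =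
      read₃ l₀ w₂ w₃ w₄ w₅ (inj₂ r) v₁ v₂ v₃ v₄ v₅ v₀ e₁ e₂ e₃ e₄ e₅ e₀ d₁ d₂ d₃ d₄ d₅ d₀

  octagon : ∀ {k} → HasCycle k 8 → Cycle k 4
  octagon {k} c@(_ , f , f∈ , _ , f-edge) =
    from (f 0F) (f 1F) (f 2F) (f 3F) (f 4F) (f 5F) (f 6F) (f 7F)
      (f∈ 0F) (f∈ 1F) (f∈ 2F) (f∈ 3F) (f∈ 4F) (f∈ 5F) (f∈ 6F) (f∈ 7F)
      (f-edge 0F) (f-edge 1F) (f-edge 2F) (f-edge 3F) (f-edge 4F) (f-edge 5F) (f-edge 6F) (f-edge 7F)
      (apart c 0F 2F (λ ())) (apart c 1F 3F (λ ())) (apart c 2F 4F (λ ())) (apart c 3F 5F (λ ()))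
      (apart c 4F 6F (λ ())) (apart c 5F 7F (λ ())) (apart c 6F 0F (λ ())) (apart c 7F 1F (λ ()))
    where
    from : ∀ (w₀ w₁ w₂ w₃ w₄ w₅ w₆ w₇ : Vertex k) →
      IsVertex w₀ → IsVertex w₁ → IsVertex w₂ → IsVertex w₃ → IsVertex w₄ → IsVertex w₅ → IsVertex w₆ → IsVertex w₇ →
      Edge k w₀ w₁ → Edge k w₁ w₂ → Edge k w₂ w₃ → Edge k w₃ w₄ →
      Edge k w₄ w₅ → Edge k w₅ w₆ → Edge k w₆ w₇ → Edge k w₇ w₀ →
      w₀ ≢ w₂ → w₁ ≢ w₃ → w₂ ≢ w₄ → w₃ ≢ w₅ → w₄ ≢ w₆ → w₅ ≢ w₇ → w₆ ≢ w₀ → w₇ ≢ w₁ → Cycle k 4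
    from (inj₁ l₀) w₁ w₂ w₃ w₄ w₅ w₆ w₇ v₀ v₁ v₂ v₃ v₄ v₅ v₆ v₇ e₀ e₁ e₂ e₃ e₄ e₅ e₆ e₇ d₀ d₁ d₂ d₃ d₄ d₅ d₆ d₇ =
      read₄ l₀ w₁ w₂ w₃ w₄ w₅ w₆ w₇ v₀ v₁ v₂ v₃ v₄ v₅ v₆ v₇ e₀ e₁ e₂ e₃ e₄ e₅ e₆ e₇ d₀ d₁ d₂ d₃ d₄ d₅ d₆ d₇
    from (inj₂ r) (inj₁ l₀) w₂ w₃ w₄ w₅ w₆ w₇ v₀ v₁ v₂ v₃ v₄ v₅ v₆ v₇ e₀ e₁ e₂ e₃ e₄ e₅ e₆ e₇ d₀ d₁ d₂ d₃ d₄ d₅ d₆ d₇ =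
      read₄ l₀ w₂ w₃ w₄ w₅ w₆ w₇ (inj₂ r) v₁ v₂ v₃ v₄ v₅ v₆ v₇ v₀ e₁ e₂ e₃ e₄ e₅ e₆ e₇ e₀ d₁ d₂ d₃ d₄ d₅ d₆ d₇ d₀

  typed⇒HasCycle : ∀ {k u v} → TypedCycle k 3 u v → HasCycle k 8
  typed⇒HasCycle {k} T = s≤s (s≤s (s≤s z≤n)) , f , f∈ , f-inj , f-edge
    where
    open TypedCycle T
    vertex : Fin 4 × Fin 2 → Vertex k
    vertex (i , 0F) = inj₁ (l i)
    vertex (i , 1F) = inj₂ (r i)
    vertex-injective : ∀ p p' → vertex p ≡ vertex p' → p ≡ p'
    vertex-injective (i , 0F) (j , 0F) e = cong (_, 0F) (l-inj i j (inj₁-injective e))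
    vertex-injective (i , 1F) (j , 1F) e = cong (_, 1F) (r-inj i j (inj₂-injective e))
    vertex-injective (i , 0F) (j , 1F) ()
    vertex-injective (i , 1F) (j , 0F) ()
    f : Fin 8 → Vertex k
    f = vertex ∘ remQuot 2
    f∈ : ∀ i → IsVertex (f i)
    f∈ i with remQuot {4} 2 i
    ... | j , 0F = l∈L j
    ... | j , 1F = r∈R j
    f-inj : ∀ i j → f i ≡ f j → i ≡ j
    f-inj i j e = trans (sym (Finₚ.combine-remQuot {4} 2 i))
      (trans (cong (uncurry combine) (vertex-injective _ _ e)) (Finₚ.combine-remQuot {4} 2 j))
    f-edge : ∀ i → Edge k (f i) (f (next i))
    f-edge 0F = adj-lr 0F
    f-edge 1F = adj-rl 0F
    f-edge 2F = adj-lr 1F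
    f-edge 3F = adj-rl 1F
    f-edge 4F = adj-lr 2F
    f-edge 5F = adj-rl 2F
    f-edge 6F = adj-lr 3F
    f-edge 7F = adj-rl 3F

  enumerate : Fin q → Carrier
  enumerate = Inverse.from enum

  enumerate-injective : ∀ i j → enumerate i ≡ enumerate j → i ≡ j
  enumerate-injective i j = Injection.injective (↔⇒↣ (↔-sym enum))

  injection-size : ∀ {n} (e : Fin n → Carrier) → (∀ i j → e i ≡ e j → i ≡ j) → n ≤ q
  injection-size {n} e e-inj with n ℕ.≤? q
  ... | yes n≤q = n≤q
  ... | no  n≰q with Finₚ.pigeonhole (ℕₚ.≰⇒> n≰q) (Inverse.to enum ∘ e)
  ...   | i , j , i<j , eᵢ≡eⱼ = ⊥-elim (Finₚ.<⇒≢ i<j (e-inj i j (Injection.injective (↔⇒↣ enum) eᵢ≡eⱼ)))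

  avoid : ∀ {m n} → m < n → (e : Fin n → Carrier) → (∀ i j → e i ≡ e j → i ≡ j) →
          (xs : Fin m → Carrier) → ∃ λ i → ∀ c → e i ≢ xs c
  avoid {m} {n} m<n e e-inj xs with Finₚ.all? (λ i → Finₚ.any? (λ c → e i ≟ xs c))
  ... | yes covered with Finₚ.pigeonhole m<n (proj₁ ∘ covered)
  ...   | i , j , i<j , cᵢ≡cⱼ = ⊥-elim (Finₚ.<⇒≢ i<j (e-inj i j
          (trans (proj₂ (covered i)) (trans (cong xs cᵢ≡cⱼ) (sym (proj₂ (covered j)))))))
  avoid {m} {n} m<n e e-inj xs | no ¬covered with Finₚ.¬∀⟶∃¬ n _ (λ i → Finₚ.any? (λ c → e i ≟ xs c)) ¬covered
  ... | i , ¬hit = i , λ c eᵢ≡x → ¬hit (c , eᵢ≡x)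

  pick : ∀ {n} → n ≤ q → Fin n → Carrier
  pick n≤q i = enumerate (inject≤ i n≤q)

  pick-injective : ∀ {n} (n≤q : n ≤ q) i j → pick n≤q i ≡ pick n≤q j → i ≡ j
  pick-injective n≤q i j = Finₚ.inject≤-injective n≤q n≤q i j ∘ enumerate-injective _ _

  no-four-distinct : q ≡ 3 → ∀ a b c d → a ≢ b → b ≢ c → c ≢ d → d ≢ a → a ≢ c → b ≢ d → ⊥
  no-four-distinct q≡3 a b c d a≢b b≢c c≢d d≢a a≢c b≢d with subst (4 ≤_) q≡3 (injection-size table table-injective)
    where
    table : Fin 4 → Carrier
    table = lookup (a ∷ b ∷ c ∷ d ∷ [])
    table-injective : ∀ i j → table i ≡ table j → i ≡ j
    table-injective = injective₄ table (λ { 0F → a≢b ; 1F → b≢c ; 2F → c≢d ; 3F → d≢a }) a≢c b≢d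
  ... | s≤s (s≤s (s≤s ()))

  -- 0, 1, z, z + 1 would be four distinct elements of 𝔽₃ for any z ∉ {0, 1}.
  char≢2 : q ≡ 3 → ¬ Char2
  char≢2 q≡3 1+1≡0 with avoid (s≤s (s≤s (s≤s z≤n))) (pick 3≤q) (pick-injective 3≤q) (lookup (0# ∷ 1# ∷ []))
    where
    3≤q : 3 ≤ q
    3≤q = ℕₚ.≤-reflexive (sym q≡3)
  ... | i , ∉ = no-four-distinct q≡3 0# 1# (z + 1#) z 0≢1 1≢z+1 z+1≢z (∉ 0F) 0≢z+1 (∉ 1F ∘ sym)
    where
    z : Carrier
    z = pick (ℕₚ.≤-reflexive (sym q≡3)) i
    1≢z+1 : 1# ≢ z + 1#
    1≢z+1 e = ∉ 0F (trans (solve 1 (λ z → z := z :+ :1 :- :1) refl z)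
                      (trans (cong (_- 1#) (sym e)) (-‿inverseʳ 1#)))
    z+1≢z : z + 1# ≢ z
    z+1≢z e = 1≢0 (+-cancelˡ z 1# 0# (trans e (sym (+-identityʳ z))))
    0≢z+1 : 0# ≢ z + 1#
    0≢z+1 e = ∉ 1F (trans (x+y≡0⇒y≡-x (trans (+-comm 1# z) (sym e))) (sym (x+y≡0⇒y≡-x 1+1≡0)))

  module _ (u₁ v₁ u₂ v₂ u₃ v₃ u₄ v₄ : Carrier) (nonzero : NonZero8 u₁ v₁ u₂ v₂ u₃ v₃ u₄ v₄) where

    private
      u₁≢0 : u₁ ≢ 0#
      u₁≢0 = proj₁ nonzero
      v₁≢0 : v₁ ≢ 0#
      v₁≢0 = proj₁ (proj₂ nonzero)
      u₂≢0 : u₂ ≢ 0#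
      u₂≢0 = proj₁ (proj₂ (proj₂ nonzero))

    part-a : (HasType8 3 u₁ v₁ u₂ v₂ u₃ v₃ u₄ v₄ × v₁ + v₂ ≡ 0#) ⇔ SpecialForm u₁ v₁ u₂ v₂ u₃ v₃ u₄ v₄
    part-a = mk⇔
      (λ (T , v₁+v₂≡0) → let open TypedOctagon T ℕₚ.≤-refl in
        symmetric⇒SpecialForm increments (symmetric v₁+v₂≡0) u₁≢0 v₁≢0 u₂≢0)
      (λ { (r , s , t , r≢0 , s≢0 , t≢0 , refl , refl , refl , refl , refl , refl , refl , refl) →
        symmetricCycle₃ r s t r≢0 s≢0 t≢0 , -‿inverseʳ s })

    part-b : (HasType8 4 u₁ v₁ u₂ v₂ u₃ v₃ u₄ v₄ × v₁ + v₂ ≡ 0#) ⇔ (Char2 × SpecialForm u₁ v₁ u₂ v₂ u₃ v₃ u₄ v₄)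
    part-b = mk⇔
      (λ (T , v₁+v₂≡0) → let open TypedOctagon T (s≤s (s≤s (s≤s z≤n))) in
        symmetric⇒char2 (symmetric v₁+v₂≡0) (d-closes ℕₚ.≤-refl) A≢0 U₁≢0 U₂≢0 ,
        symmetric⇒SpecialForm increments (symmetric v₁+v₂≡0) u₁≢0 v₁≢0 u₂≢0)
      (λ { (1+1≡0 , r , s , t , r≢0 , s≢0 , t≢0 , refl , refl , refl , refl , refl , refl , refl , refl) →
        symmetricCycle₄ r s t r≢0 s≢0 t≢0 1+1≡0 , -‿inverseʳ s })

    part-c : (HasType8 3 u₁ v₁ u₂ v₂ u₃ v₃ u₄ v₄ × v₁ + v₂ ≢ 0#)
      ⇔ (Σ Carrier λ t → Σ Carrier λ a → Σ Carrier λ b → Σ Carrier λ c →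
           GoodTABC t a b c × EqsC t a b c u₁ v₁ u₂ v₂ u₃ v₃ u₄ v₄)
    part-c = mk⇔
      (λ (T , v₁+v₂≢0) → let open TypedOctagon T ℕₚ.≤-refl in
        let (t , good , eqs) = vandermonde⇒EqsC increments (vandermonde v₁+v₂≢0) A≢0 C≢0 B≢A C≢B in
        t , A , B , C , good , eqs)
      (λ { (t , a , b , c , good@(_ , _ , b≢0 , _) , refl , refl , refl , refl , refl , refl , refl , refl) →
        kernelCycle₃ t a b c good , b≢0 ∘ trans (b≡a+[b-a] a b) })

    part-d : (HasType8 4 u₁ v₁ u₂ v₂ u₃ v₃ u₄ v₄ × v₁ + v₂ ≢ 0#)
      ⇔ (Σ Carrier λ t → Σ Carrier λ a → Σ Carrier λ b → Σ Carrier λ c →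
           GoodTABC t a b c × a + c ≡ b × EqsC t a b c u₁ v₁ u₂ v₂ u₃ v₃ u₄ v₄)
    part-d = mk⇔
      (λ (T , v₁+v₂≢0) → let open TypedOctagon T (s≤s (s≤s (s≤s z≤n))) in
        let (t , good , eqs) = vandermonde⇒EqsC increments (vandermonde v₁+v₂≢0) A≢0 C≢0 B≢A C≢B in
        t , A , B , C , good , vandermonde⇒A+C≡B A≢0 C≢0 B≢A C≢B (vandermonde v₁+v₂≢0) (d-closes ℕₚ.≤-refl) , eqs)
      (λ { (t , a , b , c , good@(_ , _ , b≢0 , _) , a+c≡b , refl , refl , refl , refl , refl , refl , refl , refl) →
        kernelCycle₄ t a b c good a+c≡b , b≢0 ∘ trans (b≡a+[b-a] a b) })

  no-short-cycle : ∀ {k} → 3 ≤ k → ∀ m → m < 8 → ¬ HasCycle k m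
  no-short-cycle 3≤k 0 _ (() , _)
  no-short-cycle 3≤k 1 _ (s≤s () , _)
  no-short-cycle 3≤k 2 _ (s≤s (s≤s ()) , _)
  no-short-cycle 3≤k 3 _ = no-odd-cycle 1 0F refl
  no-short-cycle 3≤k 4 _ = no-quadrilateral (ℕₚ.≤-trans (s≤s (s≤s z≤n)) 3≤k) ∘ quadrilateral
  no-short-cycle 3≤k 5 _ = no-odd-cycle 2 0F refl
  no-short-cycle 3≤k 6 _ = no-hexagon 3≤k ∘ hexagon
  no-short-cycle 3≤k 7 _ = no-odd-cycle 3 0F refl
  no-short-cycle 3≤k (suc (suc (suc (suc (suc (suc (suc (suc _))))))))
    (s≤s (s≤s (s≤s (s≤s (s≤s (s≤s (s≤s (s≤s ()))))))))

  girth≥10 : ∀ {k} → 3 ≤ k → ¬ HasCycle k 8 → GirthGe k 10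
  girth≥10 3≤k no-octagon₈ m m<10 with ℕₚ.<-cmp m 8
  ... | tri< m<8 _ _ = no-short-cycle 3≤k m m<8
  ... | tri≈ _ refl _ = no-octagon₈
  ... | tri> _ _ 8<m rewrite ℕₚ.≤-antisym (ℕₚ.≤-pred m<10) 8<m = no-odd-cycle 4 0F refl

  girth-Λ₃ : GirthEq 3 8
  girth-Λ₃ = typed⇒HasCycle (symmetricCycle₃ 1# 1# 1# 1≢0 1≢0 1≢0) , no-short-cycle ℕₚ.≤-refl

  girth-Λ₄ : 3 < q → GirthEq 4 8
  girth-Λ₄ 3<q with avoid ℕₚ.≤-refl (pick 3<q) (pick-injective 3<q) (lookup (0# ∷ 1# ∷ - 1# ∷ []))
  ... | i , ∉ = typed⇒HasCycle (kernelCycle₄ 1# 1# (1# + c) c good refl) , no-short-cycle (s≤s (s≤s (s≤s z≤n)))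
    where
    c : Carrier
    c = pick 3<q i
    good : GoodTABC 1# 1# (1# + c) c
    good = 1≢0 , 1≢0 , ∉ 2F ∘ x+y≡0⇒y≡-x , ∉ 0F , ∉ 0F ∘ sym ∘ +-cancelˡ 1# 0# c ∘ trans (+-identityʳ 1#) ,
           1≢0 ∘ +-cancelʳ c 1# 0# ∘ (λ e → trans e (sym (+-identityˡ c))) , ∉ 1F ∘ sym

  -- Over 𝔽₃ the Vandermonde shape would need four distinct elements 0, A, B, C.
  no-octagon-Λ₄-over-𝔽₃ : q ≡ 3 → ¬ HasCycle 4 8
  no-octagon-Λ₄-over-𝔽₃ q≡3 c =
    [ (λ s → char≢2 q≡3 (symmetric⇒char2 s (d-closes ℕₚ.≤-refl) A≢0 U₁≢0 U₂≢0))
    , (λ (B≢0 , A≢C , _) → no-four-distinct q≡3 0# A B C (A≢0 ∘ sym) (B≢A ∘ sym) (C≢B ∘ sym) C≢0 (B≢0 ∘ sym) A≢C)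
    ]′ shape
    where open Octagon (octagon c) (s≤s (s≤s (s≤s z≤n)))

theorem2 : ∀ (q : ℕ) (F : FiniteField q) →
  let open FiniteField F
      open Lambda F
  in
  -- (a)
  (∀ u₁ v₁ u₂ v₂ u₃ v₃ u₄ v₄ → NonZero8 u₁ v₁ u₂ v₂ u₃ v₃ u₄ v₄ →
    ((HasType8 3 u₁ v₁ u₂ v₂ u₃ v₃ u₄ v₄ × v₁ + v₂ ≡ 0#)
      ⇔ SpecialForm u₁ v₁ u₂ v₂ u₃ v₃ u₄ v₄))
  -- (b)
  × (∀ u₁ v₁ u₂ v₂ u₃ v₃ u₄ v₄ → NonZero8 u₁ v₁ u₂ v₂ u₃ v₃ u₄ v₄ →
    ((HasType8 4 u₁ v₁ u₂ v₂ u₃ v₃ u₄ v₄ × v₁ + v₂ ≡ 0#)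
      ⇔ (Char2 × SpecialForm u₁ v₁ u₂ v₂ u₃ v₃ u₄ v₄)))
  -- (c)
  × (∀ u₁ v₁ u₂ v₂ u₃ v₃ u₄ v₄ → NonZero8 u₁ v₁ u₂ v₂ u₃ v₃ u₄ v₄ →
    ((HasType8 3 u₁ v₁ u₂ v₂ u₃ v₃ u₄ v₄ × v₁ + v₂ ≢ 0#)
      ⇔ (Σ Carrier λ t → Σ Carrier λ a → Σ Carrier λ b → Σ Carrier λ c →
           GoodTABC t a b c × EqsC t a b c u₁ v₁ u₂ v₂ u₃ v₃ u₄ v₄)))
  -- (d)
  × (∀ u₁ v₁ u₂ v₂ u₃ v₃ u₄ v₄ → NonZero8 u₁ v₁ u₂ v₂ u₃ v₃ u₄ v₄ →
    ((HasType8 4 u₁ v₁ u₂ v₂ u₃ v₃ u₄ v₄ × v₁ + v₂ ≢ 0#)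
      ⇔ (Σ Carrier λ t → Σ Carrier λ a → Σ Carrier λ b → Σ Carrier λ c →
           GoodTABC t a b c × a + c ≡ b × EqsC t a b c u₁ v₁ u₂ v₂ u₃ v₃ u₄ v₄)))
  -- (e)
  × (3 < q → GirthEq 3 8 × GirthEq 4 8)
  -- (f)
  × (q ≡ 3 → GirthEq 3 8 × GirthGe 4 10)
  -- (g)
  × (3 ≤ q → GirthGe 5 10)
theorem2 q F =
  part-a F , part-b F , part-c F , part-d F ,
  (λ 3<q → girth-Λ₃ F , girth-Λ₄ F 3<q) ,
  (λ q≡3 → girth-Λ₃ F , girth≥10 F 3≤4 (no-octagon-Λ₄-over-𝔽₃ F q≡3)) ,
  (λ _ → girth≥10 F 3≤5 (no-octagon F ℕₚ.≤-refl ∘ octagon F))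
  where
  3≤4 : 3 ≤ 4
  3≤4 = s≤s (s≤s (s≤s z≤n))
  3≤5 : 3 ≤ 5
  3≤5 = s≤s (s≤s (s≤s z≤n))
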